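{- Let $\Gamma$ be a graph satisfying (P) and (N), let $\mathbb{H}$ be a $\{2,3\}$-hypergraph on $\mathfrak{C}(\Gamma)$ satisfying (E), and fix isomorphisms $\varphi_C:P_{v(C)}\to C$ for $C\in\mathfrak{C}(\Gamma)$. For every edge $\varepsilon\in E(\mathbb{H})$, the induced subhypergraph $(\Gamma\bullet\mathbb{H})[\overline{\varepsilon}]$ is prime.
   Context: All structures are finite. A hypergraph $H$ has vertex set $V(H)$ and edge set $E(H)\subseteq 2^{V(H)}\setminus\{\emptyset\}$; $v(H)=|V(H)|$; 3-hypergraph: all edges have 3 elements; $\{2,3\}$-hypergraph: all edges have 2 or 3 elements. $H[W]$ has vertex set $W$ and edges $\{e\in E(H):e\subseteq W\}$. $M\subseteq V(H)$ is a module if for each $e\in E(H)$ with $e\cap M\neq\emptyset$, $e\setminus M\neq\emptyset$ there is $m\in M$ with $e\cap M=\{m\}$ and $(e\setminus\{m\})\cup\{n\}\in E(H)$ for all $n\in M$. Trivial modules: $\emptyset$, $V(H)$, singletons; prime: all modules trivial and $v(H)\ge3$. For $\mathbb{W}\subseteq\mathfrak{C}(\Gamma)$, $\overline{\mathbb{W}}=\bigcup_{C\in\mathbb{W}}V(C)$. For a tournament $T$, $C_3(T)$ is the 3-hypergraph on $V(T)$ whose edges are the 3-sets inducing a 3-cycle. $L_m$: tournament on $\{0,\dots,m-1\}$ with arcs $ij$ for $i<j$; $U_{2n+1}$: obtained from $L_{2n+1}$ by reversing all arcs between two even vertices. Construction. $P_n$ is the path on $\{0,\ldots,n-1\}$ with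 edges $\{k,k+1\}$. For a graph $\Gamma$: $\mathfrak{C}(\Gamma)$ its components; $\mathfrak{C}_{\rm even}(\Gamma)$, $\mathfrak{C}_{\rm odd}(\Gamma)$ those with even/odd number of vertices; $\mathfrak{C}_1(\Gamma)$ the one-vertex components; $w(C)=\lfloor v(C)/2\rfloor$. (P): every component is a path. (N): $\mathfrak{C}(\Gamma)\setminus\mathfrak{C}_1(\Gamma)\neq\emptyset$; for each odd $C$, if $V(\Gamma)\setminus V(C)\neq\emptyset$ then $(\mathfrak{C}(\Gamma)\setminus\mathfrak{C}_1(\Gamma))\setminus\{C\}\neq\emptyset$; for each even $C$, if $|V(\Gamma)\setminus V(C)|\ge2$ then $(\mathfrak{C}(\Gamma)\setminus\mathfrak{C}_1(\Gamma))\setminus\{C\}\neq\emptyset$. (E): each 2-element edge of $\mathbb{H}$ contains one even and one odd component; each 3-element edge consists of odd components. $\Gamma\bullet\mathbb{H}$ is the 3-hypergraph on $V(\Gamma)$ whose edge set is the union of: (i) for each $C\in\mathfrak{C}_{\rm odd}(\Gamma)\setminus\mathfrak{C}_1(\Gamma)$, $\varphi_C(E(C_3(U_{v(C)})))$; (ii) for each edge $\{C,D\}$ of $\mathbb{H}$, $C$ even, $D$ odd, the sets $\{\varphi_C(2i),\varphi_C(2j+1),\varphi_D(2k)\}$, $0\le i\le j\le w(C)-1$, $0\le k\le w(D)$; (iii) for each edge $\{I,J,K\}$ of $\mathbb{H}$, the sets $\{\varphi_I(2i),\varphi_J(2j),\varphi_K(2k)\}$, $0\le i\le w(I)$, $0\le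 j\le w(J)$, $0\le k\le w(K)$. -}

module Defs where

open import Data.Nat using (ℕ; zero; suc; _+_; _*_; _≤_; _<_; _/_)
open import Data.Fin using (Fin; toℕ)
open import Data.Fin.Subset using (Subset; ⊥; ⁅_⁆; _∈_; _⊆_; _∩_; _∪_; _─_; _-_; ∣_∣; Nonempty)
open import Data.Fin.Subset.Properties using (_∈?_)
open import Data.Fin.Properties using (any?; _≟_)
open import Data.Vec using (tabulate)
open import Data.Product using (Σ; ∃; ∃-syntax; _×_; _,_)
open import Data.Sum using (_⊎_)
open import Relation.Nullary using (¬_)
open import Relation.Nullary.Decidable using (⌊_⌋; _×-dec_)
open import Relation.Binary.PropositionalEquality using (_≡_; _≢_)

Even : ℕ → Set
Even m = ∃[ k ] m ≡ 2 * k

Odd : ℕ → Set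
Odd m = ∃[ k ] m ≡ suc (2 * k)

-- Hypergraphs.  A hypergraph is given by a vertex set W ⊆ Fin n and an
-- edge predicate E on subsets of Fin n (edges are nonempty subsets of W).

EdgePred : ℕ → Set₁
EdgePred n = Subset n → Set

triple : ∀ {n} → Fin n → Fin n → Fin n → Subset n
triple a b c = (⁅ a ⁆ ∪ ⁅ b ⁆) ∪ ⁅ c ⁆

induced : ∀ {n} → EdgePred n → Subset n → EdgePred n
induced E W e = E e × e ⊆ W

IsModule : ∀ {n} → Subset n → EdgePred n → Subset n → Set
IsModule W E M =
  M ⊆ W ×
  (∀ e → E e → Nonempty (e ∩ M) → Nonempty (e ─ M) →
     ∃[ m ] (m ∈ M × e ∩ M ≡ ⁅ m ⁆ ×
             (∀ n′ → n′ ∈ M → E ((e - m) ∪ ⁅ n′ ⁆))))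

TrivialModule : ∀ {n} → Subset n → Subset n → Set
TrivialModule W M = M ≡ ⊥ ⊎ M ≡ W ⊎ ∃[ x ] (x ∈ W × M ≡ ⁅ x ⁆)

Prime : ∀ {n} → Subset n → EdgePred n → Set
Prime W E = 3 ≤ ∣ W ∣ × (∀ M → IsModule W E M → TrivialModule W M)

LArc : ∀ {m} → Fin m → Fin m → Set
LArc i j = toℕ i < toℕ j

EvenV : ∀ {m} → Fin m → Set
EvenV i = Even (toℕ i)

UArc : ∀ {m} → Fin m → Fin m → Set
UArc i j = (EvenV i × EvenV j × LArc j i) ⊎ (¬ (EvenV i × EvenV j) × LArc i j)

C3Edge : ∀ {m} → (Fin m → Fin m → Set) → EdgePred m
C3Edge A e = ∃[ a ] ∃[ b ] ∃[ c ] (A a b × A b c × A c a × e ≡ triple a b c)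

IsImage : ∀ {m n} → (Fin m → Fin n) → Subset m → Subset n → Set
IsImage φ f e = ∀ y → (y ∈ e → ∃[ x ] (x ∈ f × φ x ≡ y)) × (∀ x → x ∈ f → φ x ∈ e)

-- A graph Γ on Fin n satisfying (P), together with fixed isomorphisms
-- φ_C : P_{s C} → C.  The components are indexed by Fin c; component C
-- has s C ≥ 1 vertices and φ C : Fin (s C) → Fin n.

record PathGraph (n : ℕ) : Set₁ where
  field
    Adj      : Fin n → Fin n → Set
    Adj-irr  : ∀ u → ¬ Adj u u
    Adj-sym  : ∀ u v → Adj u v → Adj v u
    c        : ℕ
    s        : Fin c → ℕ
    s-pos    : ∀ C → 1 ≤ s C
    φ        : (C : Fin c) → Fin (s C) → Fin n
    φ-cover  : ∀ v → ∃[ C ] ∃[ x ] φ C x ≡ v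
    φ-inj    : ∀ C D (x : Fin (s C)) (y : Fin (s D)) → φ C x ≡ φ D y →
               _≡_ {A = Σ (Fin c) (λ C → Fin (s C))} (C , x) (D , y)
    Adj-path : ∀ u v → (Adj u v →
                 ∃[ C ] ∃[ x ] ∃[ y ] (toℕ y ≡ suc (toℕ x) ×
                   ((φ C x ≡ u × φ C y ≡ v) ⊎ (φ C x ≡ v × φ C y ≡ u))))
               × (∀ C (x y : Fin (s C)) → toℕ y ≡ suc (toℕ x) → Adj (φ C x) (φ C y))

module _ {n : ℕ} (Γ : PathGraph n) where
  open PathGraph Γ

  w : Fin c → ℕ
  w C = s C / 2

  InComp : Fin c → Fin n → Set
  InComp C v = ∃[ x ] φ C x ≡ v

  At : Fin c → ℕ → Fin n → Set
  At C p v = ∃[ x ] (toℕ x ≡ p × φ C x ≡ v)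

  NonTrivialComp : Fin c → Set
  NonTrivialComp C = 2 ≤ s C

  CondN : Set
  CondN =
    (∃[ C ] NonTrivialComp C) ×
    (∀ C → Odd (s C) → (∃[ v ] ¬ InComp C v) →
       ∃[ D ] (D ≢ C × NonTrivialComp D)) ×
    (∀ C → Even (s C) → (∃[ u ] ∃[ v ] (u ≢ v × ¬ InComp C u × ¬ InComp C v)) →
       ∃[ D ] (D ≢ C × NonTrivialComp D))

  Is23Hypergraph : EdgePred c → Set
  Is23Hypergraph EH = ∀ ε → EH ε → ∣ ε ∣ ≡ 2 ⊎ ∣ ε ∣ ≡ 3

  CondE : EdgePred c → Set
  CondE EH =
    (∀ ε → EH ε → ∣ ε ∣ ≡ 2 → ∃[ C ] ∃[ D ] (ε ≡ ⁅ C ⁆ ∪ ⁅ D ⁆ × Even (s C) × Odd (s D))) ×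
    (∀ ε → EH ε → ∣ ε ∣ ≡ 3 → ∀ C → C ∈ ε → Odd (s C))

  Bullet : EdgePred c → EdgePred n
  Bullet EH e =
    (∃[ C ] (Odd (s C) × NonTrivialComp C ×
       ∃[ f ] (C3Edge (UArc {s C}) f × IsImage (φ C) f e)))
    ⊎
    (∃[ C ] ∃[ D ] (EH (⁅ C ⁆ ∪ ⁅ D ⁆) × C ≢ D × Even (s C) × Odd (s D) ×
       ∃[ i ] ∃[ j ] ∃[ k ] (i ≤ j × suc j ≤ w C × k ≤ w D ×
         ∃[ a ] ∃[ b ] ∃[ d ] (At C (2 * i) a × At C (suc (2 * j)) b × At D (2 * k) d ×
           e ≡ triple a b d))))
    ⊎
    (∃[ I ] ∃[ J ] ∃[ K ] (EH (triple I J K) × I ≢ J × J ≢ K × I ≢ K ×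
       ∃[ i ] ∃[ j ] ∃[ k ] (i ≤ w I × j ≤ w J × k ≤ w K ×
         ∃[ a ] ∃[ b ] ∃[ d ] (At I (2 * i) a × At J (2 * j) b × At K (2 * k) d ×
           e ≡ triple a b d))))

  -- \overline{ε} = ⋃_{C ∈ ε} V(C)
  closure : Subset c → Subset n
  closure ε = tabulate λ v → ⌊ any? (λ C → (C ∈? ε) ×-dec any? (λ x → φ C x ≟ v)) ⌋

-- Write a vertex of Γ as φ_C(k): component C, position k. In these coordinates every edge of
-- (Γ • ℍ)[ε̄] has one of a few explicit shapes. In a module M, an edge with two vertices in M lies
-- in M, and an edge meeting M only in x stays an edge when x is exchanged for any y ∈ M. Hence if
-- exchanging x ∈ M for y ∈ M turns some edge through x into a non-edge, that edge lies in M.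
-- Starting from two distinct vertices of M, a case analysis on their components and the parities
-- of their positions produces such blocked exchanges until M contains even vertices of two
-- different components; from there M absorbs every vertex of ε̄ edge by edge. So every module
-- with two elements is ε̄, and ε̄ has at least three vertices.
module Submission where

open import Defs
open import Data.Nat using (ℕ; zero; suc; _*_; _≤_; _<_; _/_; z≤n; s≤s; s≤s⁻¹; pred)
open import Data.Nat.Properties
  using (*-suc; *-comm; *-cancelˡ-≡; *-cancelˡ-≤; *-cancelˡ-<; *-monoʳ-≤; *-monoʳ-<; even≢odd;
         ≤-refl; ≤-trans; ≤-antisym; <⇒≤; <⇒≢; <⇒≱; ≤-<-trans; <-≤-trans; <-trans; n≤1+n; m<n⇒n≢0; <-cmp)
open import Data.Nat.DivMod using (m*n/n≡m; /-monoˡ-≤)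
open import Data.Fin using (Fin; zero; suc; toℕ; fromℕ<; _≟_)
open import Data.Fin.Properties using (toℕ-injective; toℕ<n; toℕ-fromℕ<; any?)
open import Data.Fin.Subset
  using (Subset; inside; outside; ⁅_⁆; _∈_; _∉_; _⊆_; _∪_; _─_; _-_; ∣_∣; Nonempty)
open import Data.Fin.Subset.Properties
  using (_∈?_; x∈⁅x⁆; x∈⁅y⁆⇒x≡y; x∈p∪q⁻; x∈p∪q⁺; x∈p∩q⁺; x∈p∧x∉q⇒x∈p─q; x∈p∧x≢y⇒x∈p-y; p─q⊆p; p⊂q⇒∣p∣<∣q∣;
         ⊆-antisym; p─⊥≡p; nonempty?; Empty-unique; ∣⊥∣≡0)
open import Data.Bool.Properties using (T-≡)
open import Function.Bundles using (module Equivalence)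
open import Data.Vec using (_∷_; here; there)
open import Data.Vec.Properties using (lookup∘tabulate; []=⇒lookup; lookup⇒[]=)
open import Data.Product using (∃-syntax; _×_; _,_; proj₁; proj₂; map₂)
open import Data.Sum using (_⊎_; inj₁; inj₂)
open import Data.Empty using (⊥-elim)
open import Relation.Nullary using (¬_; yes; no; ¬?)
open import Relation.Nullary.Decidable using (_×-dec_; fromWitness; toWitness)
open import Relation.Binary using (tri<; tri≈; tri>)
open import Relation.Binary.PropositionalEquality
  using (_≡_; _≢_; refl; sym; trans; cong; subst; subst₂; ≢-sym)

even⇒¬odd : ∀ {m} → Even m → ¬ Odd m
even⇒¬odd (a , refl) (b , eq) = even≢odd a b eq

even-or-odd : ∀ m → Even m ⊎ Odd m
even-or-odd zero = inj₁ (0 , refl)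
even-or-odd (suc m) with even-or-odd m
... | inj₁ (k , refl) = inj₂ (k , refl)
... | inj₂ (k , refl) = inj₁ (suc k , sym (*-suc 2 k))

¬even⇒odd : ∀ {m} → ¬ Even m → Odd m
¬even⇒odd {m} ¬e with even-or-odd m
... | inj₁ e = ⊥-elim (¬e e)
... | inj₂ o = o

2*-injective : ∀ {a b} → 2 * a ≡ 2 * b → a ≡ b
2*-injective = *-cancelˡ-≡ _ _ 2

1+2*-injective : ∀ {a b} → suc (2 * a) ≡ suc (2 * b) → a ≡ b
1+2*-injective eq = 2*-injective (cong pred eq)

2a<2b⇒a<b : ∀ {a b} → 2 * a < 2 * b → a < b
2a<2b⇒a<b = *-cancelˡ-< 2 _ _

a<b⇒2a<2b : ∀ {a b} → a < b → 2 * a < 2 * b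
a<b⇒2a<2b = *-monoʳ-< 2

2a<1+2b⇒a≤b : ∀ {a b} → 2 * a < suc (2 * b) → a ≤ b
2a<1+2b⇒a≤b p = *-cancelˡ-≤ 2 (s≤s⁻¹ p)

a≤b⇒2a<1+2b : ∀ {a b} → a ≤ b → 2 * a < suc (2 * b)
a≤b⇒2a<1+2b p = s≤s (*-monoʳ-≤ 2 p)

1+2a<2b⇒a<b : ∀ {a b} → suc (2 * a) < 2 * b → a < b
1+2a<2b⇒a<b {a} {b} p = *-cancelˡ-≤ 2 (subst (_≤ 2 * b) (sym (*-suc 2 a)) p)

a<b⇒1+2a<2b : ∀ {a b} → a < b → suc (2 * a) < 2 * b
a<b⇒1+2a<2b {a} {b} p = subst (_≤ 2 * b) (*-suc 2 a) (*-monoʳ-≤ 2 p)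

2i≤s⇒i≤s/2 : ∀ {i s} → 2 * i ≤ s → i ≤ s / 2
2i≤s⇒i≤s/2 {i} {s} p = subst (_≤ s / 2) (trans (cong (_/ 2) (*-comm 2 i)) (m*n/n≡m i 2)) (/-monoˡ-≤ 2 p)

1+2j<s⇒1+j≤s/2 : ∀ {j s} → suc (2 * j) < s → suc j ≤ s / 2
1+2j<s⇒1+j≤s/2 {j} {s} p = 2i≤s⇒i≤s/2 (subst (_≤ s) (sym (*-suc 2 j)) p)

squeeze : ∀ {α m β l} → α ≤ m → m < β → (α ≡ l ⊎ α ≡ suc l) → (β ≡ l ⊎ β ≡ suc l) → m ≡ l
squeeze α≤m m<β (inj₁ refl) (inj₂ refl) = ≤-antisym (s≤s⁻¹ m<β) α≤m
squeeze α≤m m<β (inj₁ refl) (inj₁ refl) = ⊥-elim (<⇒≱ (≤-<-trans α≤m m<β) ≤-refl)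
squeeze α≤m m<β (inj₂ refl) (inj₁ refl) = ⊥-elim (<⇒≱ (≤-<-trans α≤m m<β) (n≤1+n _))
squeeze α≤m m<β (inj₂ refl) (inj₂ refl) = ⊥-elim (<⇒≱ (≤-<-trans α≤m m<β) ≤-refl)

OneOf : ∀ {n} → Fin n → Fin n → Fin n → Fin n → Set
OneOf a b d u = u ≡ a ⊎ u ≡ b ⊎ u ≡ d

IsTriple : ∀ {n} → Subset n → Fin n → Fin n → Fin n → Set
IsTriple e a b d = ∀ u → (u ∈ e → OneOf a b d u) × (OneOf a b d u → u ∈ e)

isTriple-triple : ∀ {n} (a b d : Fin n) → IsTriple (triple a b d) a b d
isTriple-triple a b d u = to , from
  where
  to : u ∈ triple a b d → OneOf a b d u
  to h with x∈p∪q⁻ (⁅ a ⁆ ∪ ⁅ b ⁆) ⁅ d ⁆ h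
  ... | inj₂ h′ = inj₂ (inj₂ (x∈⁅y⁆⇒x≡y d h′))
  ... | inj₁ h′ with x∈p∪q⁻ ⁅ a ⁆ ⁅ b ⁆ h′
  ... | inj₁ h″ = inj₁ (x∈⁅y⁆⇒x≡y a h″)
  ... | inj₂ h″ = inj₂ (inj₁ (x∈⁅y⁆⇒x≡y b h″))
  from : OneOf a b d u → u ∈ triple a b d
  from (inj₁ refl) = x∈p∪q⁺ (inj₁ (x∈p∪q⁺ (inj₁ (x∈⁅x⁆ a))))
  from (inj₂ (inj₁ refl)) = x∈p∪q⁺ (inj₁ (x∈p∪q⁺ (inj₂ (x∈⁅x⁆ b))))
  from (inj₂ (inj₂ refl)) = x∈p∪q⁺ (inj₂ (x∈⁅x⁆ d))

module _ {n} {a b d : Fin n} where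

  a∈triple : a ∈ triple a b d
  a∈triple = proj₂ (isTriple-triple a b d a) (inj₁ refl)

  b∈triple : b ∈ triple a b d
  b∈triple = proj₂ (isTriple-triple a b d b) (inj₂ (inj₁ refl))

  d∈triple : d ∈ triple a b d
  d∈triple = proj₂ (isTriple-triple a b d d) (inj₂ (inj₂ refl))

oneOf⇒ : ∀ {n} {x y z a b d u : Fin n} → IsTriple (triple x y z) a b d → OneOf x y z u → OneOf a b d u
oneOf⇒ {x = x} {y} {z} {u = u} t h = proj₁ (t u) (proj₂ (isTriple-triple x y z u) h)

oneOf⇐ : ∀ {n} {x y z a b d u : Fin n} → IsTriple (triple x y z) a b d → OneOf a b d u → OneOf x y z u
oneOf⇐ {x = x} {y} {z} {u = u} t h = proj₁ (isTriple-triple x y z u) (proj₂ (t u) h)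

isTriple⇒≡triple : ∀ {n} {e : Subset n} {a b d} → IsTriple e a b d → e ≡ triple a b d
isTriple⇒≡triple {a = a} {b} {d} t =
  ⊆-antisym (λ {u} h → proj₂ (isTriple-triple a b d u) (proj₁ (t u) h))
            (λ {u} h → proj₂ (t u) (proj₁ (isTriple-triple a b d u) h))

isTriple-rotate : ∀ {n} {e : Subset n} {a b d} → IsTriple e a b d → IsTriple e b d a
isTriple-rotate t u = (λ h → forth (proj₁ (t u) h)) , (λ h → proj₂ (t u) (back h))
  where
  forth : ∀ {a b d} → OneOf a b d u → OneOf b d a u
  forth (inj₁ x) = inj₂ (inj₂ x)
  forth (inj₂ (inj₁ x)) = inj₁ x
  forth (inj₂ (inj₂ x)) = inj₂ (inj₁ x)
  back : ∀ {a b d} → OneOf b d a u → OneOf a b d u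
  back (inj₁ x) = inj₂ (inj₁ x)
  back (inj₂ (inj₁ x)) = inj₂ (inj₂ x)
  back (inj₂ (inj₂ x)) = inj₁ x

isTriple-swap : ∀ {n} {e : Subset n} {a b d} → IsTriple e a b d → IsTriple e b a d
isTriple-swap t u = (λ h → swap (proj₁ (t u) h)) , (λ h → proj₂ (t u) (swap h))
  where
  swap : ∀ {a b d} → OneOf a b d u → OneOf b a d u
  swap (inj₁ x) = inj₂ (inj₁ x)
  swap (inj₂ (inj₁ x)) = inj₁ x
  swap (inj₂ (inj₂ x)) = inj₂ (inj₂ x)

triple-rotate : ∀ {n} (a b d : Fin n) → triple a b d ≡ triple b d a
triple-rotate a b d = isTriple⇒≡triple (isTriple-rotate (isTriple-triple a b d))

triple-swap : ∀ {n} (a b d : Fin n) → triple a b d ≡ triple b a d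
triple-swap a b d = isTriple⇒≡triple (isTriple-swap (isTriple-triple a b d))

x∈p─q⇒x∉q : ∀ {n} (p q : Subset n) {x} → x ∈ p ─ q → x ∉ q
x∈p─q⇒x∉q (_ ∷ p) (outside ∷ q) {zero} here = λ ()
x∈p─q⇒x∉q (_ ∷ p) (_ ∷ q) {suc x} (there h) (there h′) = x∈p─q⇒x∉q p q h h′

∈p-x⁻ : ∀ {n} {p : Subset n} {x y} → y ∈ p - x → y ∈ p × y ≢ x
∈p-x⁻ {p = p} {x} h = p─q⊆p p ⁅ x ⁆ h , λ { refl → x∈p─q⇒x∉q p ⁅ x ⁆ h (x∈⁅x⁆ x) }

triple-replace : ∀ {n} (m b d y : Fin n) → b ≢ m → d ≢ m → (triple m b d - m) ∪ ⁅ y ⁆ ≡ triple y b d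
triple-replace m b d y b≢m d≢m = isTriple⇒≡triple replaced
  where
  replaced : IsTriple ((triple m b d - m) ∪ ⁅ y ⁆) y b d
  replaced u = to , from
    where
    to : u ∈ (triple m b d - m) ∪ ⁅ y ⁆ → OneOf y b d u
    to h with x∈p∪q⁻ (triple m b d - m) ⁅ y ⁆ h
    ... | inj₂ h′ = inj₁ (x∈⁅y⁆⇒x≡y y h′)
    ... | inj₁ h′ with ∈p-x⁻ h′
    ... | u∈mbd , u≢m with proj₁ (isTriple-triple m b d u) u∈mbd
    ... | inj₁ u≡m = ⊥-elim (u≢m u≡m)
    ... | inj₂ u∈bd = inj₂ u∈bd
    from : OneOf y b d u → u ∈ (triple m b d - m) ∪ ⁅ y ⁆
    from (inj₁ refl) = x∈p∪q⁺ (inj₂ (x∈⁅x⁆ y))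
    from (inj₂ (inj₁ refl)) = x∈p∪q⁺ (inj₁ (x∈p∧x≢y⇒x∈p-y b∈triple b≢m))
    from (inj₂ (inj₂ refl)) = x∈p∪q⁺ (inj₁ (x∈p∧x≢y⇒x∈p-y d∈triple d≢m))

∣p∣≡1+∣p-x∣ : ∀ {n} (p : Subset n) x → x ∈ p → ∣ p ∣ ≡ suc ∣ p - x ∣
∣p∣≡1+∣p-x∣ (inside ∷ p) zero here = cong (λ q → suc ∣ q ∣) (sym (p─⊥≡p p))
∣p∣≡1+∣p-x∣ (inside ∷ p) (suc x) (there h) = cong suc (∣p∣≡1+∣p-x∣ p x h)
∣p∣≡1+∣p-x∣ (outside ∷ p) (suc x) (there h) = ∣p∣≡1+∣p-x∣ p x h

3≤∣p∣ : ∀ {n} {p : Subset n} {x y z} → x ∈ p → y ∈ p → z ∈ p → x ≢ y → x ≢ z → y ≢ z → 3 ≤ ∣ p ∣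
3≤∣p∣ {p = p} {x} {y} {z} x∈p y∈p z∈p x≢y x≢z y≢z =
  subst (3 ≤_) (sym (trans (∣p∣≡1+∣p-x∣ p x x∈p)
                    (cong suc (trans (∣p∣≡1+∣p-x∣ (p - x) y y∈p-x)
                                     (cong suc (∣p∣≡1+∣p-x∣ (p - x - y) z z∈p-x-y))))))
    (s≤s (s≤s (s≤s z≤n)))
  where
  y∈p-x : y ∈ p - x
  y∈p-x = x∈p∧x≢y⇒x∈p-y y∈p (≢-sym x≢y)
  z∈p-x-y : z ∈ p - x - y
  z∈p-x-y = x∈p∧x≢y⇒x∈p-y (x∈p∧x≢y⇒x∈p-y z∈p (≢-sym x≢z)) (≢-sym y≢z)

∣p∣≡1+k⇒nonempty : ∀ {n} {p : Subset n} {k} → ∣ p ∣ ≡ suc k → Nonempty p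
∣p∣≡1+k⇒nonempty {n} {p} eq with nonempty? p
... | yes ne = ne
... | no ¬ne with trans (sym eq) (trans (cong ∣_∣ (Empty-unique ¬ne)) (∣⊥∣≡0 n))
... | ()

∣p∣≡1+k⇒∣p-x∣≡k : ∀ {n} (p : Subset n) {k} x → x ∈ p → ∣ p ∣ ≡ suc k → ∣ p - x ∣ ≡ k
∣p∣≡1+k⇒∣p-x∣≡k p x x∈p eq = cong pred (trans (sym (∣p∣≡1+∣p-x∣ p x x∈p)) eq)

third-member : ∀ {n} {p : Subset n} {x y} → ∣ p ∣ ≡ 3 → x ∈ p → y ∈ p → x ≢ y → ∃[ z ] (z ∈ p × z ≢ x × z ≢ y)
third-member {p = p} {x} {y} ∣p∣≡3 x∈p y∈p x≢y
  with ∣p∣≡1+k⇒nonempty (∣p∣≡1+k⇒∣p-x∣≡k (p - x) y (x∈p∧x≢y⇒x∈p-y y∈p (≢-sym x≢y))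
                                          (∣p∣≡1+k⇒∣p-x∣≡k p x x∈p ∣p∣≡3))
... | z , z∈p-x-y with ∈p-x⁻ {p = p - x} z∈p-x-y
... | z∈p-x , z≢y with ∈p-x⁻ z∈p-x
... | z∈p , z≢x = z , z∈p , z≢x , z≢y

other-members : ∀ {n} {p : Subset n} {x} → ∣ p ∣ ≡ 3 → x ∈ p →
  ∃[ y ] ∃[ z ] (y ∈ p × z ∈ p × y ≢ x × z ≢ x × y ≢ z)
other-members {p = p} {x} ∣p∣≡3 x∈p with ∣p∣≡1+k⇒nonempty (∣p∣≡1+k⇒∣p-x∣≡k p x x∈p ∣p∣≡3)
... | y , y∈p-x with ∈p-x⁻ y∈p-x
... | y∈p , y≢x with third-member ∣p∣≡3 x∈p y∈p (≢-sym y≢x)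
... | z , z∈p , z≢x , z≢y = y , z , y∈p , z∈p , y≢x , z≢x , ≢-sym z≢y

three-members⇒≡triple : ∀ {n} {p : Subset n} {x y z} → ∣ p ∣ ≡ 3 → x ∈ p → y ∈ p → z ∈ p →
  x ≢ y → x ≢ z → y ≢ z → triple x y z ≡ p
three-members⇒≡triple {p = p} {x} {y} {z} ∣p∣≡3 x∈p y∈p z∈p x≢y x≢z y≢z = ⊆-antisym sub sup
  where
  sub : triple x y z ⊆ p
  sub {u} h with proj₁ (isTriple-triple x y z u) h
  ... | inj₁ refl = x∈p
  ... | inj₂ (inj₁ refl) = y∈p
  ... | inj₂ (inj₂ refl) = z∈p
  sup : p ⊆ triple x y z
  sup {u} u∈p with u ∈? triple x y z
  ... | yes h = h
  ... | no u∉xyz = ⊥-elim (<⇒≱ (subst (∣ triple x y z ∣ <_) ∣p∣≡3 (p⊂q⇒∣p∣<∣q∣ (sub , u , u∈p , u∉xyz)))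
                             (3≤∣p∣ a∈triple b∈triple d∈triple x≢y x≢z y≢z))

module ModuleProperties {n} {W : Subset n} {E : EdgePred n} {M : Subset n} (mod : IsModule W E M) where

  absorb : ∀ {e x y z} → E e → x ∈ e → y ∈ e → x ≢ y → x ∈ M → y ∈ M → z ∈ e → z ∈ M
  absorb {e} {x} {y} {z} Ee x∈e y∈e x≢y x∈M y∈M z∈e with z ∈? M
  ... | yes z∈M = z∈M
  ... | no z∉M with proj₂ mod e Ee (x , x∈p∩q⁺ (x∈e , x∈M)) (z , x∈p∧x∉q⇒x∈p─q z∈e z∉M)
  ... | m , _ , e∩M≡m , _ = ⊥-elim (
    x≢y (trans (x∈⁅y⁆⇒x≡y m (subst (x ∈_) e∩M≡m (x∈p∩q⁺ (x∈e , x∈M))))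
               (sym (x∈⁅y⁆⇒x≡y m (subst (y ∈_) e∩M≡m (x∈p∩q⁺ (y∈e , y∈M)))))))

  replace : ∀ {e m z y} → E e → m ∈ e → m ∈ M → z ∈ e → z ∉ M → y ∈ M → E ((e - m) ∪ ⁅ y ⁆)
  replace {e} {m} {z} {y} Ee m∈e m∈M z∈e z∉M y∈M
    with proj₂ mod e Ee (m , x∈p∩q⁺ (m∈e , m∈M)) (z , x∈p∧x∉q⇒x∈p─q z∈e z∉M)
  ... | m′ , _ , e∩M≡m′ , swap with x∈⁅y⁆⇒x≡y m′ (subst (m ∈_) e∩M≡m′ (x∈p∩q⁺ (m∈e , m∈M)))
  ... | refl = swap y y∈M

  blocked-swap⇒⊆ : ∀ {a b d y} → E (triple a b d) → b ≢ a → d ≢ a → a ∈ M → y ∈ M →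
                   ¬ E (triple y b d) → triple a b d ⊆ M
  blocked-swap⇒⊆ {a} {b} {d} {y} Ee b≢a d≢a a∈M y∈M ¬Ey with b ∈? M | d ∈? M
  ... | yes b∈M | _ = absorb Ee a∈triple b∈triple (≢-sym b≢a) a∈M b∈M
  ... | no _ | yes d∈M = absorb Ee a∈triple d∈triple (≢-sym d≢a) a∈M d∈M
  ... | no b∉M | no d∉M =
    ⊥-elim (¬Ey (subst E (triple-replace a b d y b≢a d≢a) (replace Ee a∈triple a∈M b∈triple b∉M y∈M)))

prime-if-pairs-fill : ∀ {n} {W : Subset n} {E : EdgePred n} → 3 ≤ ∣ W ∣ →
  (∀ M → IsModule W E M → ∀ x y → x ∈ M → y ∈ M → x ≢ y → W ⊆ M) → Prime W E
prime-if-pairs-fill {W = W} {E} 3≤∣W∣ fill = 3≤∣W∣ , trivial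
  where
  trivial : ∀ M → IsModule W E M → TrivialModule W M
  trivial M mod with nonempty? M
  ... | no ¬ne = inj₁ (Empty-unique ¬ne)
  ... | yes (x , x∈M) with any? (λ y → (y ∈? M) ×-dec ¬? (y ≟ x))
  ... | yes (y , y∈M , y≢x) = inj₂ (inj₁ (⊆-antisym (proj₁ mod) (fill M mod y x y∈M x∈M y≢x)))
  ... | no ¬other = inj₂ (inj₂ (x , proj₁ mod x∈M , ⊆-antisym M⊆x x⊆M))
    where
    M⊆x : M ⊆ ⁅ x ⁆
    M⊆x {y} y∈M with y ≟ x
    ... | yes refl = x∈⁅x⁆ x
    ... | no y≢x = ⊥-elim (¬other (y , y∈M , y≢x))
    x⊆M : ⁅ x ⁆ ⊆ M
    x⊆M y∈x rewrite x∈⁅y⁆⇒x≡y x y∈x = x∈M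

module Coordinates {n : ℕ} (Γ : PathGraph n) where
  open PathGraph Γ

  comp : Fin n → Fin c
  comp v = proj₁ (φ-cover v)

  pos : Fin n → ℕ
  pos v = toℕ (proj₁ (proj₂ (φ-cover v)))

  φ-coords : ∀ {C x v} → φ C x ≡ v → comp v ≡ C × pos v ≡ toℕ x
  φ-coords {C} {x} {v} φCx≡v with φ-inj (comp v) C _ x (trans (proj₂ (proj₂ (φ-cover v))) (sym φCx≡v))
  ... | refl = refl , refl

  at-coords : ∀ {X p v} → At Γ X p v → comp v ≡ X × pos v ≡ p
  at-coords (x , toℕx≡p , φXx≡v) = proj₁ (φ-coords φXx≡v) , trans (proj₂ (φ-coords φXx≡v)) toℕx≡p

  coords⇒at : ∀ {v X p} → comp v ≡ X → pos v ≡ p → At Γ X p v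
  coords⇒at {v} refl refl = proj₁ (proj₂ (φ-cover v)) , refl , proj₂ (proj₂ (φ-cover v))

  at-functional : ∀ {X p u v} → At Γ X p u → At Γ X p v → u ≡ v
  at-functional (x , refl , refl) (y , x≡y , refl) = cong (φ _) (toℕ-injective (sym x≡y))

  coords-injective : ∀ {u v} → comp u ≡ comp v → pos u ≡ pos v → u ≡ v
  coords-injective {u} eq₁ eq₂ = at-functional (coords⇒at eq₁ eq₂) (coords⇒at refl refl)

  vertex-at : ∀ X p → p < s X → ∃[ v ] At Γ X p v
  vertex-at X p p<s = φ X (fromℕ< p<s) , fromℕ< p<s , toℕ-fromℕ< p<s , refl

  at-bound : ∀ {X p v} → At Γ X p v → p < s X
  at-bound {X} (x , refl , _) = toℕ<n x

  ∈closure⁺ : ∀ {ε v} → comp v ∈ ε → v ∈ closure Γ ε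
  ∈closure⁺ {ε} {v} h =
    lookup⇒[]= v _ (trans (lookup∘tabulate _ v) (Equivalence.to T-≡ (fromWitness (comp v , h , proj₂ (φ-cover v)))))

  ∈closure⁻ : ∀ {ε v} → v ∈ closure Γ ε → comp v ∈ ε
  ∈closure⁻ {ε} {v} h with toWitness {a? = any? (λ C → (C ∈? ε) ×-dec any? (λ x → φ C x ≟ v))}
                                     (Equivalence.from T-≡ (trans (sym (lookup∘tabulate _ v)) ([]=⇒lookup h)))
  ... | C , C∈ε , x , φCx≡v = subst (_∈ ε) (sym (proj₁ (φ-coords φCx≡v))) C∈ε

  record AtEven (X : Fin c) (i : ℕ) (v : Fin n) : Set where
    constructor atEven
    field at : At Γ X (2 * i) v

  record AtOdd (X : Fin c) (j : ℕ) (v : Fin n) : Set where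
    constructor atOdd
    field at : At Γ X (suc (2 * j)) v

  atEven-comp : ∀ {X i v} → AtEven X i v → comp v ≡ X
  atEven-comp (atEven a) = proj₁ (at-coords a)

  atOdd-comp : ∀ {X j v} → AtOdd X j v → comp v ≡ X
  atOdd-comp (atOdd a) = proj₁ (at-coords a)

  atEven-pos : ∀ {X i v} → AtEven X i v → Even (pos v)
  atEven-pos {i = i} (atEven a) = i , proj₂ (at-coords a)

  atOdd-pos : ∀ {X j v} → AtOdd X j v → Odd (pos v)
  atOdd-pos {j = j} (atOdd a) = j , proj₂ (at-coords a)

  atEven-index : ∀ {X Y i i′ u v} → u ≡ v → AtEven X i u → AtEven Y i′ v → i ≡ i′
  atEven-index refl (atEven a) (atEven b) = 2*-injective (trans (sym (proj₂ (at-coords a))) (proj₂ (at-coords b)))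

  atOdd-index : ∀ {X Y j j′ u v} → u ≡ v → AtOdd X j u → AtOdd Y j′ v → j ≡ j′
  atOdd-index refl (atOdd a) (atOdd b) = 1+2*-injective (trans (sym (proj₂ (at-coords a))) (proj₂ (at-coords b)))

  atEven≢atOdd : ∀ {X Y i j u v} → AtEven X i u → AtOdd Y j v → u ≢ v
  atEven≢atOdd {i = i} {j} (atEven a) (atOdd b) refl =
    even≢odd i j (trans (sym (proj₂ (at-coords a))) (proj₂ (at-coords b)))

  atEven-≢ : ∀ {X i i′ u v} → AtEven X i u → AtEven X i′ v → i ≢ i′ → u ≢ v
  atEven-≢ a b i≢i′ u≡v = i≢i′ (atEven-index u≡v a b)

  comp-≢ : ∀ {u v} → comp u ≢ comp v → u ≢ v
  comp-≢ c≢ refl = c≢ refl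

  oneOf-comp : ∀ {a b d w X} → OneOf a b d w → comp a ≡ X → comp b ≡ X → comp d ≡ X → comp w ≡ X
  oneOf-comp (inj₁ refl) ca _ _ = ca
  oneOf-comp (inj₂ (inj₁ refl)) _ cb _ = cb
  oneOf-comp (inj₂ (inj₂ refl)) _ _ cd = cd

  oneOf-even : ∀ {a b d w} → OneOf a b d w → Even (pos a) → Even (pos b) → Even (pos d) → Even (pos w)
  oneOf-even (inj₁ refl) ea _ _ = ea
  oneOf-even (inj₂ (inj₁ refl)) _ eb _ = eb
  oneOf-even (inj₂ (inj₂ refl)) _ _ ed = ed

  oneOf-apart : ∀ {a b d w w′} → comp a ≢ comp b → comp b ≢ comp d → comp a ≢ comp d →
                OneOf a b d w → OneOf a b d w′ → comp w ≡ comp w′ → w ≡ w′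
  oneOf-apart _ _ _ (inj₁ refl) (inj₁ refl) _ = refl
  oneOf-apart ab _ _ (inj₁ refl) (inj₂ (inj₁ refl)) c = ⊥-elim (ab c)
  oneOf-apart _ _ ad (inj₁ refl) (inj₂ (inj₂ refl)) c = ⊥-elim (ad c)
  oneOf-apart ab _ _ (inj₂ (inj₁ refl)) (inj₁ refl) c = ⊥-elim (ab (sym c))
  oneOf-apart _ _ _ (inj₂ (inj₁ refl)) (inj₂ (inj₁ refl)) _ = refl
  oneOf-apart _ bd _ (inj₂ (inj₁ refl)) (inj₂ (inj₂ refl)) c = ⊥-elim (bd c)
  oneOf-apart _ _ ad (inj₂ (inj₂ refl)) (inj₁ refl) c = ⊥-elim (ad (sym c))
  oneOf-apart _ bd _ (inj₂ (inj₂ refl)) (inj₂ (inj₁ refl)) c = ⊥-elim (bd (sym c))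
  oneOf-apart _ _ _ (inj₂ (inj₂ refl)) (inj₂ (inj₂ refl)) _ = refl

  InnerAt : Fin c → Fin n → Fin n → Fin n → Set
  InnerAt X a b d = ∃[ α ] ∃[ m ] ∃[ β ] (AtEven X α a × AtOdd X m b × AtEven X β d × α ≤ m × m < β)

  innerAt-comp : ∀ {X a b d u} → InnerAt X a b d → OneOf a b d u → comp u ≡ X
  innerAt-comp (_ , _ , _ , aa , ab , ad , _) h = oneOf-comp h (atEven-comp aa) (atOdd-comp ab) (atEven-comp ad)

  inner-around-odd : ∀ {X Y l l′ y u v a b d} → AtOdd X l′ y → AtEven X l u → AtEven X (suc l) v →
    IsTriple (triple y u v) a b d → InnerAt Y a b d → l′ ≡ l
  inner-around-odd {l = l} {l′} {y = y} {u} {v} {a} {b} {d} ay au av t (_ , _ , _ , aa , ab , ad , α≤m , m<β) =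
    trans (sym (odd-index (oneOf⇐ t (inj₂ (inj₁ refl))) ab))
          (squeeze α≤m m<β (even-index (oneOf⇐ t (inj₁ refl)) aa) (even-index (oneOf⇐ t (inj₂ (inj₂ refl))) ad))
    where
    even-index : ∀ {w Z γ} → OneOf y u v w → AtEven Z γ w → γ ≡ l ⊎ γ ≡ suc l
    even-index (inj₁ refl) aw = ⊥-elim (atEven≢atOdd aw ay refl)
    even-index (inj₂ (inj₁ refl)) aw = inj₁ (atEven-index refl aw au)
    even-index (inj₂ (inj₂ refl)) aw = inj₂ (atEven-index refl aw av)
    odd-index : ∀ {w Z γ} → OneOf y u v w → AtOdd Z γ w → γ ≡ l′
    odd-index (inj₁ refl) aw = atOdd-index refl aw ay
    odd-index (inj₂ (inj₁ refl)) aw = ⊥-elim (atEven≢atOdd au aw refl)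
    odd-index (inj₂ (inj₂ refl)) aw = ⊥-elim (atEven≢atOdd av aw refl)

  module OddComponent (X : Fin c) (q : ℕ) (s-X : s X ≡ suc (2 * q)) where

    vertex⁰ : ∀ k → k ≤ q → ∃[ v ] AtEven X k v
    vertex⁰ k k≤q = map₂ atEven (vertex-at X (2 * k) (subst (2 * k <_) (sym s-X) (a≤b⇒2a<1+2b k≤q)))

    vertex¹ : ∀ l → l < q → ∃[ v ] AtOdd X l v
    vertex¹ l l<q = map₂ atOdd (vertex-at X (suc (2 * l)) (subst (suc (2 * l) <_) (sym s-X) (s≤s (a<b⇒2a<2b l<q))))

    bound⁰ : ∀ {k v} → AtEven X k v → k ≤ q
    bound⁰ {k} (atEven a) = 2a<1+2b⇒a≤b (subst (2 * k <_) s-X (at-bound a))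

    bound¹ : ∀ {l v} → AtOdd X l v → l < q
    bound¹ {l} (atOdd a) = 2a<2b⇒a<b (s≤s⁻¹ (subst (suc (2 * l) <_) s-X (at-bound a)))

OddBetweenEvens : ℕ → ℕ → ℕ → Set
OddBetweenEvens x y z =
  ∃[ α ] ∃[ l ] ∃[ β ] (x ≡ 2 * α × y ≡ suc (2 * l) × z ≡ 2 * β × α ≤ l × l < β)

UArcℕ : ℕ → ℕ → Set
UArcℕ i j = (Even i × Even j × j < i) ⊎ (¬ (Even i × Even j) × i < j)

-- A 3-cycle of U_m must use one reversed (even-even) arc, so it runs 2β → 2α → 2l+1 → 2β.
u-cycle-shape : ∀ {a b c} → UArcℕ a b → UArcℕ b c → UArcℕ c a →
  OddBetweenEvens a b c ⊎ OddBetweenEvens b c a ⊎ OddBetweenEvens c a b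
u-cycle-shape (inj₁ (_ , _ , b<a)) (inj₁ (_ , _ , c<b)) (inj₁ (_ , _ , a<c)) =
  ⊥-elim (<⇒≱ (<-trans a<c (<-trans c<b b<a)) ≤-refl)
u-cycle-shape (inj₁ (_ , Eb , _)) (inj₂ (¬bc , _)) (inj₁ (Ec , _ , _)) = ⊥-elim (¬bc (Eb , Ec))
u-cycle-shape (inj₂ (¬ab , _)) (inj₁ (Eb , _ , _)) (inj₁ (_ , Ea , _)) = ⊥-elim (¬ab (Ea , Eb))
u-cycle-shape (inj₁ (Ea , _ , _)) (inj₁ (_ , Ec , _)) (inj₂ (¬ca , _)) = ⊥-elim (¬ca (Ec , Ea))
u-cycle-shape (inj₂ (_ , a<b)) (inj₂ (_ , b<c)) (inj₂ (_ , c<a)) =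
  ⊥-elim (<⇒≱ (<-trans a<b (<-trans b<c c<a)) ≤-refl)
u-cycle-shape (inj₂ (¬ab , a<b)) (inj₂ (_ , b<c)) (inj₁ ((β , refl) , (α , refl) , _))
  with ¬even⇒odd (λ Eb → ¬ab ((α , refl) , Eb))
... | l , refl = inj₁ (α , l , β , refl , refl , refl , 2a<1+2b⇒a≤b a<b , 1+2a<2b⇒a<b b<c)
u-cycle-shape (inj₁ ((β , refl) , (α , refl) , _)) (inj₂ (¬bc , b<c)) (inj₂ (_ , c<a))
  with ¬even⇒odd (λ Ec → ¬bc ((α , refl) , Ec))
... | l , refl = inj₂ (inj₁ (α , l , β , refl , refl , refl , 2a<1+2b⇒a≤b b<c , 1+2a<2b⇒a<b c<a))
u-cycle-shape (inj₂ (_ , a<b)) (inj₁ ((β , refl) , (α , refl) , _)) (inj₂ (¬ca , c<a))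
  with ¬even⇒odd (λ Ea → ¬ca ((α , refl) , Ea))
... | l , refl = inj₂ (inj₂ (α , l , β , refl , refl , refl , 2a<1+2b⇒a≤b c<a , 1+2a<2b⇒a<b a<b))

image-triple : ∀ {m n} (g : Fin m → Fin n) x y z → IsImage g (triple x y z) (triple (g x) (g y) (g z))
image-triple g x y z u = to , from
  where
  to : u ∈ triple (g x) (g y) (g z) → ∃[ t ] (t ∈ triple x y z × g t ≡ u)
  to h with proj₁ (isTriple-triple (g x) (g y) (g z) u) h
  ... | inj₁ refl = x , a∈triple , refl
  ... | inj₂ (inj₁ refl) = y , b∈triple , refl
  ... | inj₂ (inj₂ refl) = z , d∈triple , refl
  from : ∀ t → t ∈ triple x y z → g t ∈ triple (g x) (g y) (g z)
  from t h with proj₁ (isTriple-triple x y z t) h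
  ... | inj₁ refl = a∈triple
  ... | inj₂ (inj₁ refl) = b∈triple
  ... | inj₂ (inj₂ refl) = d∈triple

image-of-triple : ∀ {m n} (g : Fin m → Fin n) x y z {e} → IsImage g (triple x y z) e → e ≡ triple (g x) (g y) (g z)
image-of-triple g x y z {e} img = ⊆-antisym e⊆ ⊆e
  where
  e⊆ : e ⊆ triple (g x) (g y) (g z)
  e⊆ {u} h with proj₁ (img u) h
  ... | t , t∈ , refl = proj₂ (image-triple g x y z (g t)) t t∈
  ⊆e : triple (g x) (g y) (g z) ⊆ e
  ⊆e {u} h with proj₁ (isTriple-triple (g x) (g y) (g z) u) h
  ... | inj₁ refl = proj₂ (img u) x a∈triple
  ... | inj₂ (inj₁ refl) = proj₂ (img u) y b∈triple
  ... | inj₂ (inj₂ refl) = proj₂ (img u) z d∈triple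

module BulletEdges {n : ℕ} (Γ : PathGraph n) (EH : Subset (PathGraph.c Γ) → Set) where
  open PathGraph Γ
  open Coordinates Γ

  InnerShape : Fin n → Fin n → Fin n → Set
  InnerShape a b d = comp a ≡ comp d × comp b ≡ comp d × Odd (s (comp d)) × OddBetweenEvens (pos a) (pos b) (pos d)

  PairShape : Fin n → Fin n → Fin n → Set
  PairShape a b d = comp a ≡ comp b × Even (s (comp a)) × Odd (s (comp d)) ×
    ∃[ i ] ∃[ j ] ∃[ k ] (pos a ≡ 2 * i × pos b ≡ suc (2 * j) × pos d ≡ 2 * k × i ≤ j)

  TripleShape : Fin n → Fin n → Fin n → Set
  TripleShape a b d = comp a ≢ comp b × comp b ≢ comp d × comp a ≢ comp d × Even (pos a) × Even (pos b) × Even (pos d)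

  innerShape-φ : ∀ {X} x y z → Odd (s X) → OddBetweenEvens (toℕ x) (toℕ y) (toℕ z) → InnerShape (φ X x) (φ X y) (φ X z)
  innerShape-φ {X} x y z X-odd (α , l , β , x≡ , y≡ , z≡ , α≤l , l<β)
    with φ-coords {X} {x} refl | φ-coords {X} {y} refl | φ-coords {X} {z} refl
  ... | cx , px | cy , py | cz , pz =
    trans cx (sym cz) , trans cy (sym cz) , subst (λ C → Odd (s C)) (sym cz) X-odd ,
    α , l , β , trans px x≡ , trans py y≡ , trans pz z≡ , α≤l , l<β

  innerShape⇒innerAt : ∀ {a b d} → InnerShape a b d → InnerAt (comp d) a b d
  innerShape⇒innerAt (ca , cb , _ , α , l , β , pa , pb , pd , α≤l , l<β) =
    α , l , β , atEven (coords⇒at ca pa) , atOdd (coords⇒at cb pb) , atEven (coords⇒at refl pd) , α≤l , l<β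

  BulletShape : Subset n → Set
  BulletShape e = ∃[ a ] ∃[ b ] ∃[ d ] (IsTriple e a b d × (InnerShape a b d ⊎ PairShape a b d ⊎ TripleShape a b d))

  bullet-shape : ∀ {e} → Bullet Γ EH e → BulletShape e
  bullet-shape (inj₁ (X , X-odd , _ , _ , (x , y , z , xy , yz , zx , refl) , img))
    with subst (λ e → IsTriple e (φ X x) (φ X y) (φ X z)) (sym (image-of-triple (φ X) x y z img))
               (isTriple-triple _ _ _)
       | u-cycle-shape {toℕ x} {toℕ y} {toℕ z} xy yz zx
  ... | t | inj₁ sh = _ , _ , _ , t , inj₁ (innerShape-φ x y z X-odd sh)
  ... | t | inj₂ (inj₁ sh) = _ , _ , _ , isTriple-rotate t , inj₁ (innerShape-φ y z x X-odd sh)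
  ... | t | inj₂ (inj₂ sh) = _ , _ , _ , isTriple-rotate (isTriple-rotate t) , inj₁ (innerShape-φ z x y X-odd sh)
  bullet-shape (inj₂ (inj₁ (C , D , _ , _ , C-even , D-odd , i , j , k , i≤j , _ , _ ,
                            a , b , d , at-a , at-b , at-d , refl))) =
    a , b , d , isTriple-triple a b d ,
    inj₂ (inj₁ (trans (proj₁ (at-coords at-a)) (sym (proj₁ (at-coords at-b))) ,
                subst (λ C → Even (s C)) (sym (proj₁ (at-coords at-a))) C-even ,
                subst (λ C → Odd (s C)) (sym (proj₁ (at-coords at-d))) D-odd ,
                i , j , k , proj₂ (at-coords at-a) , proj₂ (at-coords at-b) , proj₂ (at-coords at-d) , i≤j))
  bullet-shape (inj₂ (inj₂ (I , J , K , _ , I≢J , J≢K , I≢K , i , j , k , _ , _ , _ ,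
                            a , b , d , at-a , at-b , at-d , refl))) =
    a , b , d , isTriple-triple a b d ,
    inj₂ (inj₂ (comps≢ at-a at-b I≢J , comps≢ at-b at-d J≢K , comps≢ at-a at-d I≢K ,
                (i , proj₂ (at-coords at-a)) , (j , proj₂ (at-coords at-b)) , (k , proj₂ (at-coords at-d))))
    where
    comps≢ : ∀ {X Y p q u v} → At Γ X p u → At Γ Y q v → X ≢ Y → comp u ≢ comp v
    comps≢ at-u at-v X≢Y eq = X≢Y (trans (sym (proj₁ (at-coords at-u))) (trans eq (proj₁ (at-coords at-v))))

  inner-edge : ∀ {X α l β a b d} → Odd (s X) → AtEven X α a → AtOdd X l b → AtEven X β d →
               α ≤ l → l < β → Bullet Γ EH (triple a b d)
  inner-edge {X} {α} {l} {β} X-odd (atEven (x , x≡ , refl)) (atOdd (y , y≡ , refl)) (atEven at-d@(z , z≡ , refl))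
             α≤l l<β =
    inj₁ (X , X-odd , nontrivial , triple x y z , (x , y , z , xy , yz , zx , refl) , image-triple (φ X) x y z)
    where
    nontrivial : 2 ≤ s X
    nontrivial = ≤-trans (*-monoʳ-≤ 2 (≤-trans (s≤s z≤n) l<β)) (<⇒≤ (at-bound at-d))
    y-odd : ¬ Even (toℕ y)
    y-odd y-even = even⇒¬odd y-even (l , y≡)
    xy : UArc {s X} x y
    xy = inj₂ ((λ p → y-odd (proj₂ p)) , subst₂ _<_ (sym x≡) (sym y≡) (a≤b⇒2a<1+2b α≤l))
    yz : UArc {s X} y z
    yz = inj₂ ((λ p → y-odd (proj₁ p)) , subst₂ _<_ (sym y≡) (sym z≡) (a<b⇒1+2a<2b l<β))
    zx : UArc {s X} z x
    zx = inj₁ ((β , z≡) , (α , x≡) , subst₂ _<_ (sym x≡) (sym z≡) (a<b⇒2a<2b (≤-<-trans α≤l l<β)))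

  pair-edge : ∀ {C D i j k a b d} → EH (⁅ C ⁆ ∪ ⁅ D ⁆) → C ≢ D → Even (s C) → Odd (s D) →
              AtEven C i a → AtOdd C j b → AtEven D k d → i ≤ j → Bullet Γ EH (triple a b d)
  pair-edge {C} {D} {i} {j} {k} {a} {b} {d} CD∈ℍ C≢D C-even D-odd (atEven at-a) (atOdd at-b) (atEven at-d) i≤j =
    inj₂ (inj₁ (C , D , CD∈ℍ , C≢D , C-even , D-odd , i , j , k , i≤j ,
                1+2j<s⇒1+j≤s/2 (at-bound at-b) , 2i≤s⇒i≤s/2 (<⇒≤ (at-bound at-d)) ,
                a , b , d , at-a , at-b , at-d , refl))

  triple-edge : ∀ {I J K i j k a b d} → EH (triple I J K) → I ≢ J → J ≢ K → I ≢ K →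
                AtEven I i a → AtEven J j b → AtEven K k d → Bullet Γ EH (triple a b d)
  triple-edge {I} {J} {K} {i} {j} {k} {a} {b} {d} IJK∈ℍ I≢J J≢K I≢K (atEven at-a) (atEven at-b) (atEven at-d) =
    inj₂ (inj₂ (I , J , K , IJK∈ℍ , I≢J , J≢K , I≢K , i , j , k ,
                2i≤s⇒i≤s/2 (<⇒≤ (at-bound at-a)) , 2i≤s⇒i≤s/2 (<⇒≤ (at-bound at-b)) , 2i≤s⇒i≤s/2 (<⇒≤ (at-bound at-d)) ,
                a , b , d , at-a , at-b , at-d , refl))

  induced-triple : ∀ {ε a b d} → Bullet Γ EH (triple a b d) → comp a ∈ ε → comp b ∈ ε → comp d ∈ ε →
                   induced (Bullet Γ EH) (closure Γ ε) (triple a b d)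
  induced-triple {ε} {a} {b} {d} edge a∈ε b∈ε d∈ε = edge , inside-closure
    where
    inside-closure : triple a b d ⊆ closure Γ ε
    inside-closure {u} h with proj₁ (isTriple-triple a b d u) h
    ... | inj₁ refl = ∈closure⁺ a∈ε
    ... | inj₂ (inj₁ refl) = ∈closure⁺ b∈ε
    ... | inj₂ (inj₂ refl) = ∈closure⁺ d∈ε

module PairEdge {n : ℕ} (Γ : PathGraph n) (EH : Subset (PathGraph.c Γ) → Set)
  (C D : Fin (PathGraph.c Γ)) (p q : ℕ)
  (s-C : PathGraph.s Γ C ≡ 2 * suc p) (s-D : PathGraph.s Γ D ≡ suc (2 * q))
  (CD∈ℍ : EH (⁅ C ⁆ ∪ ⁅ D ⁆)) where
  open PathGraph Γ
  open Coordinates Γ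
  open BulletEdges Γ EH
  open OddComponent D q s-D renaming (vertex⁰ to D⁰; vertex¹ to D¹; bound⁰ to D⁰-bound; bound¹ to D¹-bound)

  W : Subset n
  W = closure Γ (⁅ C ⁆ ∪ ⁅ D ⁆)

  E : EdgePred n
  E = induced (Bullet Γ EH) W

  C-even : Even (s C)
  C-even = suc p , s-C

  D-odd : Odd (s D)
  D-odd = q , s-D

  C≢D : C ≢ D
  C≢D refl = even⇒¬odd C-even D-odd

  C≢D-at : ∀ {u v} → comp u ≡ C → comp v ≡ D → u ≢ v
  C≢D-at cu cv refl = C≢D (trans (sym cu) cv)

  C∈CD : C ∈ ⁅ C ⁆ ∪ ⁅ D ⁆
  C∈CD = x∈p∪q⁺ (inj₁ (x∈⁅x⁆ C))

  D∈CD : D ∈ ⁅ C ⁆ ∪ ⁅ D ⁆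
  D∈CD = x∈p∪q⁺ (inj₂ (x∈⁅x⁆ D))

  ∈W⁻ : ∀ {v} → v ∈ W → comp v ≡ C ⊎ comp v ≡ D
  ∈W⁻ h with x∈p∪q⁻ ⁅ C ⁆ ⁅ D ⁆ (∈closure⁻ h)
  ... | inj₁ h′ = inj₁ (x∈⁅y⁆⇒x≡y C h′)
  ... | inj₂ h′ = inj₂ (x∈⁅y⁆⇒x≡y D h′)

  ∈W⁺ : ∀ {v X} → comp v ≡ X → X ∈ ⁅ C ⁆ ∪ ⁅ D ⁆ → v ∈ W
  ∈W⁺ refl X∈CD = ∈closure⁺ X∈CD

  C⁰ : ∀ i → i ≤ p → ∃[ v ] AtEven C i v
  C⁰ i i≤p = map₂ atEven (vertex-at C (2 * i) (subst (2 * i <_) (sym s-C) (a<b⇒2a<2b (s≤s i≤p))))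

  C¹ : ∀ j → j ≤ p → ∃[ v ] AtOdd C j v
  C¹ j j≤p = map₂ atOdd (vertex-at C (suc (2 * j)) (subst (suc (2 * j) <_) (sym s-C) (a<b⇒1+2a<2b (s≤s j≤p))))

  C⁰-bound : ∀ {i v} → AtEven C i v → i ≤ p
  C⁰-bound {i} (atEven a) = s≤s⁻¹ (2a<2b⇒a<b (subst (2 * i <_) s-C (at-bound a)))

  C¹-bound : ∀ {j v} → AtOdd C j v → j ≤ p
  C¹-bound {j} (atOdd a) = s≤s⁻¹ (1+2a<2b⇒a<b (subst (suc (2 * j) <_) s-C (at-bound a)))

  data Class (v : Fin n) : Set where
    c⁰ : ∀ {i} → AtEven C i v → Class v
    c¹ : ∀ {j} → AtOdd C j v → Class v
    d⁰ : ∀ {k} → AtEven D k v → Class v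
    d¹ : ∀ {l} → AtOdd D l v → Class v

  classify : ∀ {v} → v ∈ W → Class v
  classify {v} h with ∈W⁻ h | even-or-odd (pos v)
  ... | inj₁ cv | inj₁ (i , pv) = c⁰ {i = i} (atEven (coords⇒at cv pv))
  ... | inj₁ cv | inj₂ (j , pv) = c¹ {j = j} (atOdd (coords⇒at cv pv))
  ... | inj₂ cv | inj₁ (k , pv) = d⁰ {k = k} (atEven (coords⇒at cv pv))
  ... | inj₂ cv | inj₂ (l , pv) = d¹ {l = l} (atOdd (coords⇒at cv pv))

  CD-edge : ∀ {i j k a b d} → i ≤ j → AtEven C i a → AtOdd C j b → AtEven D k d → E (triple a b d)
  CD-edge i≤j aa ab ad =
    induced-triple (pair-edge CD∈ℍ C≢D C-even D-odd aa ab ad i≤j)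
      (subst (_∈ _) (sym (atEven-comp aa)) C∈CD) (subst (_∈ _) (sym (atOdd-comp ab)) C∈CD)
      (subst (_∈ _) (sym (atEven-comp ad)) D∈CD)

  D-edge : ∀ {α l β a b d} → α ≤ l → l < β → AtEven D α a → AtOdd D l b → AtEven D β d → E (triple a b d)
  D-edge α≤l l<β aa ab ad =
    induced-triple (inner-edge D-odd aa ab ad α≤l l<β)
      (subst (_∈ _) (sym (atEven-comp aa)) D∈CD) (subst (_∈ _) (sym (atOdd-comp ab)) D∈CD)
      (subst (_∈ _) (sym (atEven-comp ad)) D∈CD)

  CDShape : Fin n → Fin n → Fin n → Set
  CDShape a b d = ∃[ i ] ∃[ j ] ∃[ k ] (AtEven C i a × AtOdd C j b × AtEven D k d × i ≤ j)

  edge-shape : ∀ {e} → E e → ∃[ a ] ∃[ b ] ∃[ d ] (IsTriple e a b d × (InnerAt D a b d ⊎ CDShape a b d))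
  edge-shape (edge , e⊆W) with bullet-shape edge
  ... | a , b , d , t , shape = a , b , d , t , refine shape
    where
    in-W : ∀ {u} → OneOf a b d u → comp u ≡ C ⊎ comp u ≡ D
    in-W {u} h = ∈W⁻ (e⊆W (proj₂ (t u) h))
    two-comps : ∀ {x y z : Fin c} → (x ≡ C ⊎ x ≡ D) → (y ≡ C ⊎ y ≡ D) → (z ≡ C ⊎ z ≡ D) →
                x ≢ y → y ≢ z → x ≢ z → InnerAt D a b d ⊎ CDShape a b d
    two-comps (inj₁ refl) (inj₁ refl) _ x≢y _ _ = ⊥-elim (x≢y refl)
    two-comps (inj₂ refl) (inj₂ refl) _ x≢y _ _ = ⊥-elim (x≢y refl)
    two-comps (inj₁ refl) (inj₂ refl) (inj₁ refl) _ _ x≢z = ⊥-elim (x≢z refl)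
    two-comps (inj₁ refl) (inj₂ refl) (inj₂ refl) _ y≢z _ = ⊥-elim (y≢z refl)
    two-comps (inj₂ refl) (inj₁ refl) (inj₁ refl) _ y≢z _ = ⊥-elim (y≢z refl)
    two-comps (inj₂ refl) (inj₁ refl) (inj₂ refl) _ _ x≢z = ⊥-elim (x≢z refl)
    refine : InnerShape a b d ⊎ PairShape a b d ⊎ TripleShape a b d → InnerAt D a b d ⊎ CDShape a b d
    refine (inj₁ sh@(_ , _ , d-odd , _)) with in-W (inj₂ (inj₂ refl))
    ... | inj₁ cd = ⊥-elim (even⇒¬odd (subst (λ X → Even (s X)) (sym cd) C-even) d-odd)
    ... | inj₂ refl = inj₁ (innerShape⇒innerAt sh)
    refine (inj₂ (inj₁ (cab , a-even , d-odd , i , j , k , pa , pb , pd , i≤j)))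
      with in-W (inj₁ refl) | in-W (inj₂ (inj₂ refl))
    ... | inj₂ ca | _ = ⊥-elim (even⇒¬odd a-even (subst (λ X → Odd (s X)) (sym ca) D-odd))
    ... | _ | inj₁ cd = ⊥-elim (even⇒¬odd (subst (λ X → Even (s X)) (sym cd) C-even) d-odd)
    ... | inj₁ ca | inj₂ cd = inj₂ (i , j , k , atEven (coords⇒at ca pa) , atOdd (coords⇒at (trans (sym cab) ca) pb) ,
                                   atEven (coords⇒at cd pd) , i≤j)
    refine (inj₂ (inj₂ (ab , bd , ad , _))) =
      two-comps (in-W (inj₁ refl)) (in-W (inj₂ (inj₁ refl))) (in-W (inj₂ (inj₂ refl))) ab bd ad

  ¬edge-C¹C¹D : ∀ {j j′ y t w} → AtOdd C j y → AtOdd C j′ t → comp w ≡ D → ¬ E (triple y t w)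
  ¬edge-C¹C¹D ay at cw e with edge-shape e
  ... | _ , _ , _ , sh , inj₁ dsh = C≢D (trans (sym (atOdd-comp ay)) (innerAt-comp dsh (oneOf⇒ sh (inj₁ refl))))
  ... | _ , _ , _ , sh , inj₂ (_ , _ , _ , aa , _ , _ , _) with oneOf⇐ sh (inj₁ refl)
  ...   | inj₁ refl = atEven≢atOdd aa ay refl
  ...   | inj₂ (inj₁ refl) = atEven≢atOdd aa at refl
  ...   | inj₂ (inj₂ refl) = C≢D (trans (sym (atEven-comp aa)) cw)

  ¬edge-CDD : ∀ {x u v} → comp x ≡ C → comp u ≡ D → comp v ≡ D → ¬ E (triple x u v)
  ¬edge-CDD cx cu cv e with edge-shape e
  ... | _ , _ , _ , sh , inj₁ dsh = C≢D (trans (sym cx) (innerAt-comp dsh (oneOf⇒ sh (inj₁ refl))))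
  ... | _ , _ , _ , sh , inj₂ (_ , _ , _ , aa , ab , _ , _) with oneOf⇐ sh (inj₁ refl) | oneOf⇐ sh (inj₂ (inj₁ refl))
  ...   | inj₂ (inj₁ refl) | _ = C≢D (trans (sym (atEven-comp aa)) cu)
  ...   | inj₂ (inj₂ refl) | _ = C≢D (trans (sym (atEven-comp aa)) cv)
  ...   | inj₁ _ | inj₂ (inj₁ refl) = C≢D (trans (sym (atOdd-comp ab)) cu)
  ...   | inj₁ _ | inj₂ (inj₂ refl) = C≢D (trans (sym (atOdd-comp ab)) cv)
  ...   | inj₁ refl | inj₁ refl = atEven≢atOdd aa ab refl

  ¬edge-D¹CC : ∀ {l y u v} → AtOdd D l y → comp u ≡ C → comp v ≡ C → ¬ E (triple y u v)
  ¬edge-D¹CC ay cu cv e with edge-shape e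
  ... | _ , _ , _ , sh , inj₁ dsh = C≢D (trans (sym cu) (innerAt-comp dsh (oneOf⇒ sh (inj₂ (inj₁ refl)))))
  ... | _ , _ , _ , sh , inj₂ (_ , _ , _ , _ , _ , ad , _) with oneOf⇐ sh (inj₂ (inj₂ refl))
  ...   | inj₁ refl = atEven≢atOdd ad ay refl
  ...   | inj₂ (inj₁ refl) = C≢D (trans (sym cu) (atEven-comp ad))
  ...   | inj₂ (inj₂ refl) = C≢D (trans (sym cv) (atEven-comp ad))

  ¬edge-D¹-between : ∀ {l l′ y u v} → AtOdd D l′ y → AtEven D l u → AtEven D (suc l) v → l′ ≢ l →
                     ¬ E (triple y u v)
  ¬edge-D¹-between ay au av l′≢l e with edge-shape e
  ... | _ , _ , _ , sh , inj₁ dsh = l′≢l (inner-around-odd ay au av sh dsh)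
  ... | _ , _ , _ , sh , inj₂ (_ , _ , _ , aa , _ , _ , _) =
    C≢D (trans (sym (atEven-comp aa))
               (oneOf-comp (oneOf⇐ sh (inj₁ refl)) (atOdd-comp ay) (atEven-comp au) (atEven-comp av)))

  ¬edge-C⁰C¹D-descending : ∀ {i i′ y u w} → AtEven C i′ y → AtOdd C i u → comp w ≡ D → i < i′ → ¬ E (triple y u w)
  ¬edge-C⁰C¹D-descending ay au cw i<i′ e with edge-shape e
  ... | _ , _ , _ , sh , inj₁ dsh = C≢D (trans (sym (atEven-comp ay)) (innerAt-comp dsh (oneOf⇒ sh (inj₁ refl))))
  ... | _ , _ , _ , sh , inj₂ (_ , _ , _ , aa , ab , _ , i″≤j″)
    with oneOf⇐ sh (inj₁ refl) | oneOf⇐ sh (inj₂ (inj₁ refl))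
  ...   | inj₂ (inj₁ refl) | _ = atEven≢atOdd aa au refl
  ...   | inj₂ (inj₂ refl) | _ = C≢D (trans (sym (atEven-comp aa)) cw)
  ...   | inj₁ _ | inj₁ refl = atEven≢atOdd ay ab refl
  ...   | inj₁ _ | inj₂ (inj₂ refl) = C≢D (trans (sym (atOdd-comp ab)) cw)
  ...   | inj₁ refl | inj₂ (inj₁ refl) =
    <⇒≱ i<i′ (subst₂ _≤_ (atEven-index refl aa ay) (atOdd-index refl ab au) i″≤j″)

  c⁰₀ : ∃[ v ] AtEven C 0 v
  c⁰₀ = C⁰ 0 z≤n

  c¹₀ : ∃[ v ] AtOdd C 0 v
  c¹₀ = C¹ 0 z≤n

  c¹ₚ : ∃[ v ] AtOdd C p v
  c¹ₚ = C¹ p ≤-refl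

  d⁰₀ : ∃[ v ] AtEven D 0 v
  d⁰₀ = D⁰ 0 z≤n

  module Filling (M : Subset n) (mod : IsModule W E M) where
    open ModuleProperties mod

    fill-C⁰D⁰ : ∀ {i k x y} → AtEven C i x → x ∈ M → AtEven D k y → y ∈ M → W ⊆ M
    fill-C⁰D⁰ {x = x} {y} ax x∈M ay y∈M {u} u∈W = go (classify u∈W)
      where
      c¹ₚ∈M : proj₁ c¹ₚ ∈ M
      c¹ₚ∈M = absorb (CD-edge (C⁰-bound ax) ax (proj₂ c¹ₚ) ay) a∈triple d∈triple
                (C≢D-at (atEven-comp ax) (atEven-comp ay)) x∈M y∈M b∈triple
      C⁰⊆M : ∀ {i v} → AtEven C i v → v ∈ M
      C⁰⊆M av = absorb (CD-edge (C⁰-bound av) av (proj₂ c¹ₚ) ay) b∈triple d∈triple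
                  (C≢D-at (atOdd-comp (proj₂ c¹ₚ)) (atEven-comp ay)) c¹ₚ∈M y∈M a∈triple
      C¹⊆M : ∀ {j v} → AtOdd C j v → v ∈ M
      C¹⊆M av = absorb (CD-edge z≤n (proj₂ c⁰₀) av ay) a∈triple d∈triple
                  (C≢D-at (atEven-comp (proj₂ c⁰₀)) (atEven-comp ay)) (C⁰⊆M (proj₂ c⁰₀)) y∈M b∈triple
      D⁰⊆M : ∀ {k v} → AtEven D k v → v ∈ M
      D⁰⊆M av = absorb (CD-edge z≤n (proj₂ c⁰₀) (proj₂ c¹₀) av) a∈triple b∈triple
                  (atEven≢atOdd (proj₂ c⁰₀) (proj₂ c¹₀)) (C⁰⊆M (proj₂ c⁰₀)) (C¹⊆M (proj₂ c¹₀)) d∈triple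
      D¹⊆M : ∀ {l v} → AtOdd D l v → v ∈ M
      D¹⊆M av = absorb (D-edge z≤n (D¹-bound av) (proj₂ d⁰₀) av (proj₂ d⁰q)) a∈triple d∈triple
                  (atEven-≢ (proj₂ d⁰₀) (proj₂ d⁰q) (≢-sym (m<n⇒n≢0 (D¹-bound av))))
                  (D⁰⊆M (proj₂ d⁰₀)) (D⁰⊆M (proj₂ d⁰q)) b∈triple
        where d⁰q = D⁰ q ≤-refl
      go : Class u → u ∈ M
      go (c⁰ au) = C⁰⊆M au
      go (c¹ au) = C¹⊆M au
      go (d⁰ au) = D⁰⊆M au
      go (d¹ au) = D¹⊆M au

    fill-C¹D⁰ : ∀ {j k x y} → AtOdd C j x → x ∈ M → AtEven D k y → y ∈ M → W ⊆ M
    fill-C¹D⁰ ax x∈M ay y∈M = fill-C⁰D⁰ (proj₂ c⁰₀) c⁰₀∈M ay y∈M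
      where
      c⁰₀∈M : proj₁ c⁰₀ ∈ M
      c⁰₀∈M = absorb (CD-edge z≤n (proj₂ c⁰₀) ax ay) b∈triple d∈triple
                (C≢D-at (atOdd-comp ax) (atEven-comp ay)) x∈M y∈M a∈triple

    fill-C⁰C¹ : ∀ {i j x y} → AtEven C i x → x ∈ M → AtOdd C j y → y ∈ M → W ⊆ M
    fill-C⁰C¹ {x = x} ax x∈M ay y∈M = fill-C⁰D⁰ ax x∈M (proj₂ d⁰₀) (edge⊆M d∈triple)
      where
      edge⊆M : triple x (proj₁ c¹ₚ) (proj₁ d⁰₀) ⊆ M
      edge⊆M = blocked-swap⇒⊆ (CD-edge (C⁰-bound ax) ax (proj₂ c¹ₚ) (proj₂ d⁰₀))
                 (≢-sym (atEven≢atOdd ax (proj₂ c¹ₚ))) (≢-sym (C≢D-at (atEven-comp ax) (atEven-comp (proj₂ d⁰₀))))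
                 x∈M y∈M (¬edge-C¹C¹D ay (proj₂ c¹ₚ) (atEven-comp (proj₂ d⁰₀)))

    D⁰-neighbour∈M : ∀ {l x y} → AtOdd D l x → x ∈ M → y ∈ M →
      (∀ {u v} → AtEven D l u → AtEven D (suc l) v → ¬ E (triple y u v)) → ∃[ u ] (AtEven D l u × u ∈ M)
    D⁰-neighbour∈M {l} {x} ax x∈M y∈M ¬edge = proj₁ d⁰ₗ , proj₂ d⁰ₗ , edge⊆M b∈triple
      where
      d⁰ₗ : ∃[ v ] AtEven D l v
      d⁰ₗ = D⁰ l (<⇒≤ (D¹-bound ax))
      d⁰ₗ₊₁ : ∃[ v ] AtEven D (suc l) v
      d⁰ₗ₊₁ = D⁰ (suc l) (D¹-bound ax)
      edge⊆M : triple x (proj₁ d⁰ₗ) (proj₁ d⁰ₗ₊₁) ⊆ M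
      edge⊆M = blocked-swap⇒⊆ (subst E (triple-swap _ _ _) (D-edge ≤-refl ≤-refl (proj₂ d⁰ₗ) ax (proj₂ d⁰ₗ₊₁)))
                 (atEven≢atOdd (proj₂ d⁰ₗ) ax) (atEven≢atOdd (proj₂ d⁰ₗ₊₁) ax) x∈M y∈M
                 (¬edge (proj₂ d⁰ₗ) (proj₂ d⁰ₗ₊₁))

    D⁰-from-C-D¹ : ∀ {l x y} → comp x ≡ C → x ∈ M → AtOdd D l y → y ∈ M → ∃[ u ] (AtEven D l u × u ∈ M)
    D⁰-from-C-D¹ cx x∈M ay y∈M =
      D⁰-neighbour∈M ay y∈M x∈M (λ au av → ¬edge-CDD cx (atEven-comp au) (atEven-comp av))

    fill-D⁰D¹ : ∀ {k l x y} → AtEven D k x → x ∈ M → AtOdd D l y → y ∈ M → W ⊆ M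
    fill-D⁰D¹ {x = x} ax x∈M ay y∈M = fill-C⁰D⁰ (proj₂ c⁰₀) (edge⊆M b∈triple) ax x∈M
      where
      edge⊆M : triple x (proj₁ c⁰₀) (proj₁ c¹₀) ⊆ M
      edge⊆M = blocked-swap⇒⊆
                 (subst E (trans (triple-rotate _ _ _) (triple-rotate _ _ _)) (CD-edge z≤n (proj₂ c⁰₀) (proj₂ c¹₀) ax))
                 (C≢D-at (atEven-comp (proj₂ c⁰₀)) (atEven-comp ax)) (C≢D-at (atOdd-comp (proj₂ c¹₀)) (atEven-comp ax))
                 x∈M y∈M (¬edge-D¹CC ay (atEven-comp (proj₂ c⁰₀)) (atOdd-comp (proj₂ c¹₀)))

    fill-D⁰D⁰ : ∀ {k k′ x y} → AtEven D k x → x ∈ M → AtEven D k′ y → y ∈ M → k < k′ → W ⊆ M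
    fill-D⁰D⁰ {k} ax x∈M ay y∈M k<k′ = fill-D⁰D¹ ax x∈M (proj₂ d¹ₖ) d¹ₖ∈M
      where
      d¹ₖ : ∃[ v ] AtOdd D k v
      d¹ₖ = D¹ k (<-≤-trans k<k′ (D⁰-bound ay))
      d¹ₖ∈M : proj₁ d¹ₖ ∈ M
      d¹ₖ∈M = absorb (D-edge ≤-refl k<k′ ax (proj₂ d¹ₖ) ay) a∈triple d∈triple (atEven-≢ ax ay (<⇒≢ k<k′))
                x∈M y∈M b∈triple

    fill-D¹D¹ : ∀ {l l′ x y} → AtOdd D l x → x ∈ M → AtOdd D l′ y → y ∈ M → l′ ≢ l → W ⊆ M
    fill-D¹D¹ ax x∈M ay y∈M l′≢l =
      let (_ , au , u∈M) = D⁰-neighbour∈M ax x∈M y∈M (λ au av → ¬edge-D¹-between ay au av l′≢l)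
      in fill-D⁰D¹ au u∈M ax x∈M

    fill-C⁰C⁰ : ∀ {i i′ x y} → AtEven C i x → x ∈ M → AtEven C i′ y → y ∈ M → i < i′ → W ⊆ M
    fill-C⁰C⁰ {i} {x = x} ax x∈M ay y∈M i<i′ = fill-C⁰D⁰ ax x∈M (proj₂ d⁰₀) (edge⊆M d∈triple)
      where
      c¹ᵢ : ∃[ v ] AtOdd C i v
      c¹ᵢ = C¹ i (<⇒≤ (<-≤-trans i<i′ (C⁰-bound ay)))
      edge⊆M : triple x (proj₁ c¹ᵢ) (proj₁ d⁰₀) ⊆ M
      edge⊆M = blocked-swap⇒⊆ (CD-edge ≤-refl ax (proj₂ c¹ᵢ) (proj₂ d⁰₀))
                 (≢-sym (atEven≢atOdd ax (proj₂ c¹ᵢ))) (≢-sym (C≢D-at (atEven-comp ax) (atEven-comp (proj₂ d⁰₀))))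
                 x∈M y∈M (¬edge-C⁰C¹D-descending ay (proj₂ c¹ᵢ) (atEven-comp (proj₂ d⁰₀)) i<i′)

    fill-C¹C¹ : ∀ {j j′ x y} → AtOdd C j x → x ∈ M → AtOdd C j′ y → y ∈ M → j < j′ → W ⊆ M
    fill-C¹C¹ {j′ = j′} {y = y} ax x∈M ay y∈M j<j′ = fill-C¹D⁰ ay y∈M (proj₂ d⁰₀) (edge⊆M d∈triple)
      where
      c⁰ⱼ′ : ∃[ v ] AtEven C j′ v
      c⁰ⱼ′ = C⁰ j′ (C¹-bound ay)
      edge⊆M : triple y (proj₁ c⁰ⱼ′) (proj₁ d⁰₀) ⊆ M
      edge⊆M = blocked-swap⇒⊆ (subst E (triple-swap _ _ _) (CD-edge ≤-refl (proj₂ c⁰ⱼ′) ay (proj₂ d⁰₀)))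
                 (atEven≢atOdd (proj₂ c⁰ⱼ′) ay) (≢-sym (C≢D-at (atOdd-comp ay) (atEven-comp (proj₂ d⁰₀))))
                 y∈M x∈M
                 (λ e → ¬edge-C⁰C¹D-descending (proj₂ c⁰ⱼ′) ax (atEven-comp (proj₂ d⁰₀)) j<j′
                          (subst E (triple-swap _ _ _) e))

    fill-pair : ∀ {x y} → x ∈ M → y ∈ M → x ≢ y → Class x → Class y → W ⊆ M
    fill-pair x∈M y∈M x≢y (c⁰ {i} ax) (c⁰ {i′} ay) with <-cmp i i′
    ... | tri< i<i′ _ _ = fill-C⁰C⁰ ax x∈M ay y∈M i<i′
    ... | tri≈ _ refl _ = ⊥-elim (x≢y (at-functional (AtEven.at ax) (AtEven.at ay)))
    ... | tri> _ _ i′<i = fill-C⁰C⁰ ay y∈M ax x∈M i′<i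
    fill-pair x∈M y∈M _ (c⁰ ax) (c¹ ay) = fill-C⁰C¹ ax x∈M ay y∈M
    fill-pair x∈M y∈M _ (c⁰ ax) (d⁰ ay) = fill-C⁰D⁰ ax x∈M ay y∈M
    fill-pair x∈M y∈M _ (c⁰ ax) (d¹ ay) =
      let (_ , au , u∈M) = D⁰-from-C-D¹ (atEven-comp ax) x∈M ay y∈M in fill-C⁰D⁰ ax x∈M au u∈M
    fill-pair x∈M y∈M _ (c¹ ax) (c⁰ ay) = fill-C⁰C¹ ay y∈M ax x∈M
    fill-pair x∈M y∈M x≢y (c¹ {j} ax) (c¹ {j′} ay) with <-cmp j j′
    ... | tri< j<j′ _ _ = fill-C¹C¹ ax x∈M ay y∈M j<j′
    ... | tri≈ _ refl _ = ⊥-elim (x≢y (at-functional (AtOdd.at ax) (AtOdd.at ay)))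
    ... | tri> _ _ j′<j = fill-C¹C¹ ay y∈M ax x∈M j′<j
    fill-pair x∈M y∈M _ (c¹ ax) (d⁰ ay) = fill-C¹D⁰ ax x∈M ay y∈M
    fill-pair x∈M y∈M _ (c¹ ax) (d¹ ay) =
      let (_ , au , u∈M) = D⁰-from-C-D¹ (atOdd-comp ax) x∈M ay y∈M in fill-C¹D⁰ ax x∈M au u∈M
    fill-pair x∈M y∈M _ (d⁰ ax) (c⁰ ay) = fill-C⁰D⁰ ay y∈M ax x∈M
    fill-pair x∈M y∈M _ (d⁰ ax) (c¹ ay) = fill-C¹D⁰ ay y∈M ax x∈M
    fill-pair x∈M y∈M x≢y (d⁰ {k} ax) (d⁰ {k′} ay) with <-cmp k k′
    ... | tri< k<k′ _ _ = fill-D⁰D⁰ ax x∈M ay y∈M k<k′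
    ... | tri≈ _ refl _ = ⊥-elim (x≢y (at-functional (AtEven.at ax) (AtEven.at ay)))
    ... | tri> _ _ k′<k = fill-D⁰D⁰ ay y∈M ax x∈M k′<k
    fill-pair x∈M y∈M _ (d⁰ ax) (d¹ ay) = fill-D⁰D¹ ax x∈M ay y∈M
    fill-pair x∈M y∈M _ (d¹ ax) (c⁰ ay) =
      let (_ , au , u∈M) = D⁰-from-C-D¹ (atEven-comp ay) y∈M ax x∈M in fill-C⁰D⁰ ay y∈M au u∈M
    fill-pair x∈M y∈M _ (d¹ ax) (c¹ ay) =
      let (_ , au , u∈M) = D⁰-from-C-D¹ (atOdd-comp ay) y∈M ax x∈M in fill-C¹D⁰ ay y∈M au u∈M
    fill-pair x∈M y∈M _ (d¹ ax) (d⁰ ay) = fill-D⁰D¹ ay y∈M ax x∈M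
    fill-pair x∈M y∈M x≢y (d¹ ax) (d¹ ay) =
      fill-D¹D¹ ax x∈M ay y∈M (λ { refl → x≢y (at-functional (AtOdd.at ax) (AtOdd.at ay)) })

  prime : Prime W E
  prime = prime-if-pairs-fill
    (3≤∣p∣ (∈W⁺ (atEven-comp (proj₂ c⁰₀)) C∈CD) (∈W⁺ (atOdd-comp (proj₂ c¹₀)) C∈CD) (∈W⁺ (atEven-comp (proj₂ d⁰₀)) D∈CD)
           (atEven≢atOdd (proj₂ c⁰₀) (proj₂ c¹₀)) (C≢D-at (atEven-comp (proj₂ c⁰₀)) (atEven-comp (proj₂ d⁰₀)))
           (C≢D-at (atOdd-comp (proj₂ c¹₀)) (atEven-comp (proj₂ d⁰₀))))
    (λ M mod x y x∈M y∈M x≢y →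
       Filling.fill-pair M mod x∈M y∈M x≢y (classify (proj₁ mod x∈M)) (classify (proj₁ mod y∈M)))

module TripleEdge {n : ℕ} (Γ : PathGraph n) (EH : Subset (PathGraph.c Γ) → Set)
  (ε : Subset (PathGraph.c Γ)) (∣ε∣≡3 : ∣ ε ∣ ≡ 3) (ε∈ℍ : EH ε)
  (ε-odd : ∀ X → X ∈ ε → Odd (PathGraph.s Γ X)) where
  open PathGraph Γ
  open Coordinates Γ
  open BulletEdges Γ EH

  W : Subset n
  W = closure Γ ε

  E : EdgePred n
  E = induced (Bullet Γ EH) W

  module Sizes {X : Fin c} (X∈ε : X ∈ ε) = OddComponent X (proj₁ (ε-odd X X∈ε)) (proj₂ (ε-odd X X∈ε))
  open Sizes

  ∈W⁺ : ∀ {v X} → comp v ≡ X → X ∈ ε → v ∈ W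
  ∈W⁺ refl X∈ε = ∈closure⁺ X∈ε

  comps≢ : ∀ {u v X Y} → comp u ≡ X → comp v ≡ Y → X ≢ Y → comp u ≢ comp v
  comps≢ refl refl X≢Y = X≢Y

  inner-edge-in : ∀ {X α l β a b d} → X ∈ ε → α ≤ l → l < β → AtEven X α a → AtOdd X l b → AtEven X β d →
                  E (triple a b d)
  inner-edge-in {X} X∈ε α≤l l<β aa ab ad =
    induced-triple (inner-edge (ε-odd X X∈ε) aa ab ad α≤l l<β)
      (subst (_∈ ε) (sym (atEven-comp aa)) X∈ε) (subst (_∈ ε) (sym (atOdd-comp ab)) X∈ε)
      (subst (_∈ ε) (sym (atEven-comp ad)) X∈ε)

  cross-edge : ∀ {u v w} → u ∈ W → v ∈ W → w ∈ W → comp u ≢ comp v → comp v ≢ comp w → comp u ≢ comp w →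
               Even (pos u) → Even (pos v) → Even (pos w) → E (triple u v w)
  cross-edge {u} {v} {w} u∈W v∈W w∈W uv vw uw (i , pu) (j , pv) (k , pw) =
    induced-triple (triple-edge uvw∈ℍ uv vw uw (atEven {i = i} (coords⇒at refl pu))
                      (atEven {i = j} (coords⇒at refl pv)) (atEven {i = k} (coords⇒at refl pw)))
      (∈closure⁻ u∈W) (∈closure⁻ v∈W) (∈closure⁻ w∈W)
    where
    uvw∈ℍ : EH (triple (comp u) (comp v) (comp w))
    uvw∈ℍ = subst EH (sym (three-members⇒≡triple ∣ε∣≡3 (∈closure⁻ u∈W) (∈closure⁻ v∈W) (∈closure⁻ w∈W) uv uw vw)) ε∈ℍ

  edge-shape : ∀ {e} → E e → ∃[ a ] ∃[ b ] ∃[ d ] (IsTriple e a b d × ((∃[ X ] InnerAt X a b d) ⊎ TripleShape a b d))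
  edge-shape (edge , e⊆W) with bullet-shape edge
  ... | a , b , d , t , inj₁ sh = a , b , d , t , inj₁ (comp d , innerShape⇒innerAt sh)
  ... | a , b , d , t , inj₂ (inj₁ (_ , a-even , _)) =
    ⊥-elim (even⇒¬odd a-even (ε-odd (comp a) (∈closure⁻ (e⊆W (proj₂ (t a) (inj₁ refl))))))
  ... | a , b , d , t , inj₂ (inj₂ sh) = a , b , d , t , inj₂ sh

  ¬edge-odd-apart : ∀ {x y z} → Odd (pos x) → comp y ≢ comp z → ¬ E (triple x y z)
  ¬edge-odd-apart x-odd y≢z e with edge-shape e
  ... | _ , _ , _ , sh , inj₁ (_ , ish) =
    y≢z (trans (innerAt-comp ish (oneOf⇒ sh (inj₂ (inj₁ refl))))
               (sym (innerAt-comp ish (oneOf⇒ sh (inj₂ (inj₂ refl))))))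
  ... | _ , _ , _ , sh , inj₂ (_ , _ , _ , ea , eb , ed) = even⇒¬odd (oneOf-even (oneOf⇒ sh (inj₁ refl)) ea eb ed) x-odd

  ¬edge-apart-pair : ∀ {x u v} → comp x ≢ comp u → comp u ≡ comp v → u ≢ v → ¬ E (triple x u v)
  ¬edge-apart-pair x≢u cu≡cv u≢v e with edge-shape e
  ... | _ , _ , _ , sh , inj₁ (_ , ish) =
    x≢u (trans (innerAt-comp ish (oneOf⇒ sh (inj₁ refl))) (sym (innerAt-comp ish (oneOf⇒ sh (inj₂ (inj₁ refl))))))
  ... | _ , _ , _ , sh , inj₂ (ab , bd , ad , _) =
    u≢v (oneOf-apart ab bd ad (oneOf⇒ sh (inj₂ (inj₁ refl))) (oneOf⇒ sh (inj₂ (inj₂ refl))) cu≡cv)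

  ¬edge-odd-between : ∀ {X l l′ y u v} → AtOdd X l′ y → AtEven X l u → AtEven X (suc l) v → l′ ≢ l →
                      ¬ E (triple y u v)
  ¬edge-odd-between ay au av l′≢l e with edge-shape e
  ... | _ , _ , _ , sh , inj₁ (_ , ish) = l′≢l (inner-around-odd ay au av sh ish)
  ... | _ , _ , _ , sh , inj₂ (_ , _ , _ , ea , eb , ed) =
    even⇒¬odd (oneOf-even (oneOf⇒ sh (inj₁ refl)) ea eb ed) (atOdd-pos ay)

  module Filling (M : Subset n) (mod : IsModule W E M) where
    open ModuleProperties mod

    comp∈ε : ∀ {v} → v ∈ M → comp v ∈ ε
    comp∈ε v∈M = ∈closure⁻ (proj₁ mod v∈M)

    even-joins : ∀ {x y w} → x ∈ M → y ∈ M → Even (pos x) → Even (pos y) → comp x ≢ comp y →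
                 w ∈ W → Even (pos w) → comp w ≢ comp x → comp w ≢ comp y → w ∈ M
    even-joins x∈M y∈M ex ey x≢y w∈W ew w≢x w≢y =
      absorb (cross-edge (proj₁ mod x∈M) (proj₁ mod y∈M) w∈W x≢y (≢-sym w≢y) (≢-sym w≢x) ex ey ew)
        a∈triple b∈triple (comp-≢ x≢y) x∈M y∈M d∈triple

    evens⇒W⊆M : (∀ {w} → w ∈ W → Even (pos w) → w ∈ M) → W ⊆ M
    evens⇒W⊆M evens {w} w∈W with even-or-odd (pos w)
    ... | inj₁ ew = evens w∈W ew
    ... | inj₂ (l , pw) =
      absorb (inner-edge-in X∈ε z≤n (bound¹ X∈ε aw) (proj₂ x₀) aw (proj₂ x₀′)) a∈triple d∈triple
        (atEven-≢ (proj₂ x₀) (proj₂ x₀′) (≢-sym (m<n⇒n≢0 (bound¹ X∈ε aw))))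
        (evens (∈W⁺ (atEven-comp (proj₂ x₀)) X∈ε) (atEven-pos (proj₂ x₀)))
        (evens (∈W⁺ (atEven-comp (proj₂ x₀′)) X∈ε) (atEven-pos (proj₂ x₀′))) b∈triple
      where
      X∈ε : comp w ∈ ε
      X∈ε = ∈closure⁻ w∈W
      aw : AtOdd (comp w) l w
      aw = atOdd (coords⇒at refl pw)
      x₀ : ∃[ v ] AtEven (comp w) 0 v
      x₀ = vertex⁰ X∈ε 0 z≤n
      x₀′ : ∃[ v ] AtEven (comp w) (proj₁ (ε-odd _ X∈ε)) v
      x₀′ = vertex⁰ X∈ε (proj₁ (ε-odd _ X∈ε)) ≤-refl

    evens-from-three : ∀ {x y z} → x ∈ M → y ∈ M → z ∈ M → Even (pos x) → Even (pos y) → Even (pos z) →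
      comp x ≢ comp y → comp z ≢ comp x → comp z ≢ comp y → ∀ {w} → w ∈ W → Even (pos w) → w ∈ M
    evens-from-three {x} {y} x∈M y∈M z∈M ex ey ez x≢y z≢x z≢y {w} w∈W ew with comp w ≟ comp x | comp w ≟ comp y
    ... | yes w≡x | _ = even-joins y∈M z∈M ey ez (≢-sym z≢y) w∈W ew (λ w≡y → x≢y (trans (sym w≡x) w≡y))
                          (λ w≡z → z≢x (trans (sym w≡z) w≡x))
    ... | no _ | yes w≡y = even-joins x∈M z∈M ex ez (≢-sym z≢x) w∈W ew (λ w≡x → x≢y (trans (sym w≡x) w≡y))
                             (λ w≡z → z≢y (trans (sym w≡z) w≡y))
    ... | no w≢x | no w≢y = even-joins x∈M y∈M ex ey x≢y w∈W ew w≢x w≢y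

    fill-apart : ∀ {x y} → x ∈ M → y ∈ M → Even (pos x) → Even (pos y) → comp x ≢ comp y → W ⊆ M
    fill-apart {x} {y} x∈M y∈M ex ey x≢y with third-member ∣ε∣≡3 (comp∈ε x∈M) (comp∈ε y∈M) x≢y
    ... | Z , Z∈ε , Z≢x , Z≢y with vertex⁰ Z∈ε 0 z≤n
    ... | z , az = evens⇒W⊆M (evens-from-three x∈M y∈M z∈M ex ey (atEven-pos az) x≢y z≢x z≢y)
      where
      z≢x : comp z ≢ comp x
      z≢x = comps≢ (atEven-comp az) refl Z≢x
      z≢y : comp z ≢ comp y
      z≢y = comps≢ (atEven-comp az) refl Z≢y
      z∈M : z ∈ M
      z∈M = even-joins x∈M y∈M ex ey x≢y (∈W⁺ (atEven-comp az) Z∈ε) (atEven-pos az) z≢x z≢y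

    fill-even-odd : ∀ {X i l x y} → AtEven X i x → x ∈ M → AtOdd X l y → y ∈ M → W ⊆ M
    fill-even-odd {X} {x = x} ax x∈M ay y∈M with other-members ∣ε∣≡3 (subst (_∈ ε) (atEven-comp ax) (comp∈ε x∈M))
    ... | Y , Z , Y∈ε , Z∈ε , Y≢X , Z≢X , Y≢Z with vertex⁰ Y∈ε 0 z≤n | vertex⁰ Z∈ε 0 z≤n
    ... | u , au | v , av = fill-apart x∈M (edge⊆M b∈triple) (atEven-pos ax) (atEven-pos au) (≢-sym u≢x)
      where
      u≢x : comp u ≢ comp x
      u≢x = comps≢ (atEven-comp au) (atEven-comp ax) Y≢X
      v≢x : comp v ≢ comp x
      v≢x = comps≢ (atEven-comp av) (atEven-comp ax) Z≢X
      u≢v : comp u ≢ comp v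
      u≢v = comps≢ (atEven-comp au) (atEven-comp av) Y≢Z
      edge⊆M : triple x u v ⊆ M
      edge⊆M = blocked-swap⇒⊆
                 (cross-edge (proj₁ mod x∈M) (∈W⁺ (atEven-comp au) Y∈ε) (∈W⁺ (atEven-comp av) Z∈ε)
                    (≢-sym u≢x) u≢v (≢-sym v≢x) (atEven-pos ax) (atEven-pos au) (atEven-pos av))
                 (comp-≢ u≢x) (comp-≢ v≢x) x∈M y∈M (¬edge-odd-apart (atOdd-pos ay) u≢v)

    even-neighbour∈M : ∀ {X l x y} → AtOdd X l x → x ∈ M → y ∈ M →
      (∀ {u v} → AtEven X l u → AtEven X (suc l) v → ¬ E (triple y u v)) → ∃[ u ] (AtEven X l u × u ∈ M)
    even-neighbour∈M {X} {l} {x} ax x∈M y∈M ¬edge = proj₁ x⁰ₗ , proj₂ x⁰ₗ , edge⊆M b∈triple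
      where
      X∈ε : X ∈ ε
      X∈ε = subst (_∈ ε) (atOdd-comp ax) (comp∈ε x∈M)
      x⁰ₗ : ∃[ v ] AtEven X l v
      x⁰ₗ = vertex⁰ X∈ε l (<⇒≤ (bound¹ X∈ε ax))
      x⁰ₗ₊₁ : ∃[ v ] AtEven X (suc l) v
      x⁰ₗ₊₁ = vertex⁰ X∈ε (suc l) (bound¹ X∈ε ax)
      edge⊆M : triple x (proj₁ x⁰ₗ) (proj₁ x⁰ₗ₊₁) ⊆ M
      edge⊆M = blocked-swap⇒⊆
                 (subst E (triple-swap _ _ _) (inner-edge-in X∈ε ≤-refl ≤-refl (proj₂ x⁰ₗ) ax (proj₂ x⁰ₗ₊₁)))
                 (atEven≢atOdd (proj₂ x⁰ₗ) ax) (atEven≢atOdd (proj₂ x⁰ₗ₊₁) ax) x∈M y∈M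
                 (¬edge (proj₂ x⁰ₗ) (proj₂ x⁰ₗ₊₁))

    fill-odd-apart : ∀ {X l x v} → AtOdd X l x → x ∈ M → v ∈ M → comp v ≢ X → W ⊆ M
    fill-odd-apart {X} {l} {v = v} ax x∈M v∈M v≢X =
      let (_ , au , u∈M) = even-neighbour∈M ax x∈M v∈M ¬edge in fill-even-odd au u∈M ax x∈M
      where
      ¬edge : ∀ {u u′} → AtEven X l u → AtEven X (suc l) u′ → ¬ E (triple v u u′)
      ¬edge au au′ = ¬edge-apart-pair (λ eq → v≢X (trans eq (atEven-comp au)))
                       (trans (atEven-comp au) (sym (atEven-comp au′))) (atEven-≢ au au′ (<⇒≢ ≤-refl))

    fill-odd-odd : ∀ {X l l′ x y} → AtOdd X l x → x ∈ M → AtOdd X l′ y → y ∈ M → l′ ≢ l → W ⊆ M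
    fill-odd-odd ax x∈M ay y∈M l′≢l =
      let (_ , au , u∈M) = even-neighbour∈M ax x∈M y∈M (λ au au′ → ¬edge-odd-between ay au au′ l′≢l)
      in fill-even-odd au u∈M ax x∈M

    fill-even-even : ∀ {X i i′ x y} → AtEven X i x → x ∈ M → AtEven X i′ y → y ∈ M → i < i′ → W ⊆ M
    fill-even-even {X} {i} ax x∈M ay y∈M i<i′ = fill-even-odd ax x∈M (proj₂ x¹ᵢ) x¹ᵢ∈M
      where
      X∈ε : X ∈ ε
      X∈ε = subst (_∈ ε) (atEven-comp ax) (comp∈ε x∈M)
      x¹ᵢ : ∃[ v ] AtOdd X i v
      x¹ᵢ = vertex¹ X∈ε i (<-≤-trans i<i′ (bound⁰ X∈ε ay))
      x¹ᵢ∈M : proj₁ x¹ᵢ ∈ M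
      x¹ᵢ∈M = absorb (inner-edge-in X∈ε ≤-refl i<i′ ax (proj₂ x¹ᵢ) ay) a∈triple d∈triple
                (atEven-≢ ax ay (<⇒≢ i<i′)) x∈M y∈M b∈triple

    fill-pair : ∀ {x y} → x ∈ M → y ∈ M → x ≢ y → W ⊆ M
    fill-pair {x} {y} x∈M y∈M x≢y with even-or-odd (pos x) | even-or-odd (pos y) | comp x ≟ comp y
    ... | inj₁ ex | inj₁ ey | no cx≢cy = fill-apart x∈M y∈M ex ey cx≢cy
    ... | inj₁ (i , px) | inj₁ (i′ , py) | yes cx≡cy with <-cmp i i′
    ...   | tri< i<i′ _ _ = fill-even-even (atEven (coords⇒at refl px)) x∈M (atEven (coords⇒at (sym cx≡cy) py)) y∈M i<i′
    ...   | tri≈ _ refl _ = ⊥-elim (x≢y (coords-injective cx≡cy (trans px (sym py))))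
    ...   | tri> _ _ i′<i = fill-even-even (atEven (coords⇒at refl py)) y∈M (atEven (coords⇒at cx≡cy px)) x∈M i′<i
    fill-pair x∈M y∈M _ | inj₁ (i , px) | inj₂ (l , py) | yes cx≡cy =
      fill-even-odd (atEven {i = i} (coords⇒at cx≡cy px)) x∈M (atOdd {j = l} (coords⇒at refl py)) y∈M
    fill-pair x∈M y∈M _ | inj₁ _ | inj₂ (l , py) | no cx≢cy =
      fill-odd-apart (atOdd {j = l} (coords⇒at refl py)) y∈M x∈M cx≢cy
    fill-pair x∈M y∈M _ | inj₂ (l , px) | inj₁ (i , py) | yes cx≡cy =
      fill-even-odd (atEven {i = i} (coords⇒at (sym cx≡cy) py)) y∈M (atOdd {j = l} (coords⇒at refl px)) x∈M
    fill-pair x∈M y∈M _ | inj₂ (l , px) | _ | no cx≢cy =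
      fill-odd-apart (atOdd {j = l} (coords⇒at refl px)) x∈M y∈M (≢-sym cx≢cy)
    fill-pair x∈M y∈M x≢y | inj₂ (l , px) | inj₂ (l′ , py) | yes cx≡cy =
      fill-odd-odd (atOdd {j = l} (coords⇒at refl px)) x∈M (atOdd {j = l′} (coords⇒at (sym cx≡cy) py)) y∈M
        (λ { refl → x≢y (coords-injective cx≡cy (trans px (sym py))) })

  prime : Prime W E
  prime with ∣p∣≡1+k⇒nonempty ∣ε∣≡3
  ... | I , I∈ε with other-members ∣ε∣≡3 I∈ε
  ... | J , K , J∈ε , K∈ε , J≢I , K≢I , J≢K with vertex⁰ I∈ε 0 z≤n | vertex⁰ J∈ε 0 z≤n | vertex⁰ K∈ε 0 z≤n
  ... | i , ai | j , aj | k , ak = prime-if-pairs-fill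
    (3≤∣p∣ (∈W⁺ (atEven-comp ai) I∈ε) (∈W⁺ (atEven-comp aj) J∈ε) (∈W⁺ (atEven-comp ak) K∈ε)
           (comp-≢ (comps≢ (atEven-comp ai) (atEven-comp aj) (≢-sym J≢I)))
           (comp-≢ (comps≢ (atEven-comp ai) (atEven-comp ak) (≢-sym K≢I)))
           (comp-≢ (comps≢ (atEven-comp aj) (atEven-comp ak) J≢K)))
    (λ M mod x y x∈M y∈M x≢y → Filling.fill-pair M mod x∈M y∈M x≢y)

mainTheorem12 : ∀ {n} (Γ : PathGraph n) (EH : Subset (PathGraph.c Γ) → Set) →
    CondN Γ → Is23Hypergraph Γ EH → CondE Γ EH →
    ∀ ε → EH ε →
    Prime (closure Γ ε) (induced (Bullet Γ EH) (closure Γ ε))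
mainTheorem12 Γ EH _ is23 (pair-shape , triple-odd) ε ε∈ℍ with is23 ε ε∈ℍ
... | inj₂ ∣ε∣≡3 = TripleEdge.prime Γ EH ε ∣ε∣≡3 ε∈ℍ (triple-odd ε ε∈ℍ ∣ε∣≡3)
... | inj₁ ∣ε∣≡2 with pair-shape ε ε∈ℍ ∣ε∣≡2
...   | C , D , refl , (suc p , s-C) , (q , s-D) = PairEdge.prime Γ EH C D p q s-C s-D ε∈ℍ
...   | C , _ , _ , (zero , s-C) , _ = ⊥-elim (<⇒≱ (subst (0 <_) s-C (PathGraph.s-pos Γ C)) ≤-refl)
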